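{- Let $n,m$ be positive integers, let $F$ be a field of characteristic zero, let $X$ be an $n$-element set, and let $G$ be a subgroup of $\mathrm{Sym}(X)$. Let $\Delta:G\to F$ be any function. Then, in $F[w_1,\ldots,w_m]$, \[ \sum_{\boldsymbol{k}\in\mathcal{P}_m([n])}\left(\sum_{\boldsymbol{\alpha}\in\boldsymbol{k}(X)}\ \sum_{\sigma\in\mathrm{Sym}(\boldsymbol{\alpha})\cap G}\Delta(\sigma)\right)\boldsymbol{w}^{(\boldsymbol{k})}=\sum_{\sigma\in G}\Delta(\sigma)\,Z(\sigma,\tilde{\boldsymbol{w}}). \]
   Context: $\mathcal{P}_m([n])$ is the set of tuples $\boldsymbol{k}=(k_1,\ldots,k_m)$ of nonnegative integers with $\sum_i k_i=n$, and $\boldsymbol{w}^{(\boldsymbol{k})}=w_1^{k_1}\cdots w_m^{k_m}$. For $\boldsymbol{k}\in\mathcal{P}_m([n])$, $\boldsymbol{k}(X)$ is the set of tuples $\boldsymbol{\alpha}=(A_1,\ldots,A_m)$ of pairwise disjoint subsets of $X$ with $|A_i|=k_i$ for all $i$ (so they partition $X$). For such $\boldsymbol{\alpha}$, $\mathrm{Sym}(\boldsymbol{\alpha})=\mathrm{Sym}(A_1)\times\cdots\times\mathrm{Sym}(A_m)$, viewed as a subgroup of $\mathrm{Sym}(X)$. For $\sigma\in\mathrm{Sym}(X)$, $c_i(\sigma)$ is the number of cycles of length $i$ of $\sigma$, and for $\boldsymbol{t}=(t_1,\ldots,t_n)$, $Z(\sigma,\boldsymbol{t})=t_1^{c_1(\sigma)}\cdots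 t_n^{c_n(\sigma)}$. Finally $\tilde{\boldsymbol{w}}=\left(\sum_{i=1}^m w_i,\sum_{i=1}^m w_i^2,\ldots,\sum_{i=1}^m w_i^n\right)$. -}

module Defs where

open import Level using (Level)
open import Data.Bool using (Bool; true; false; T; if_then_else_)
open import Data.Nat using (ℕ; zero; suc; _≤_; _∸_; _≤?_; _≟_; _/_) renaming (_+_ to _+ℕ_)
open import Data.Fin using (Fin)
import Data.Fin.Properties as FinP
open import Data.Fin.Subset using (Subset; _∈_; ∣_∣)
open import Data.Fin.Subset.Properties using (_∈?_)
open import Data.Vec using (Vec; []; _∷_; lookup; tabulate; allFin; zipWith)
import Data.Vec.Properties as VecP
open import Data.List using (List; []; _∷_; foldr; map; concatMap; filter; upTo; length)
open import Data.Product using (Σ; ∃; _×_; _,_)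
open import Relation.Nullary using (¬_; Dec; yes; no)
open import Relation.Nullary.Decidable using (⌊_⌋)
open import Relation.Unary using (Decidable)
open import Relation.Binary.PropositionalEquality using (_≡_)
open import Algebra.Bundles using (CommutativeRing)
open import Data.Fin.Properties using (all?)
open import Relation.Nullary.Decidable using (_×-dec_; _→-dec_; ¬?)

allVecs : ∀ {a} {A : Set a} → List A → (k : ℕ) → List (Vec A k)
allVecs xs zero    = [] ∷ []
allVecs xs (suc k) = concatMap (λ x → map (x ∷_) (allVecs xs k)) xs

allFinList : (n : ℕ) → List (Fin n)
allFinList n = Data.Vec.toList (allFin n)

-- The symmetric group Sym(X) for X = Fin n.
-- A map X → X is stored as the vector of its values (σ x = lookup σ x).

Map : ℕ → Set
Map n = Vec (Fin n) n

app : ∀ {n} → Map n → Fin n → Fin n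
app σ x = lookup σ x

idMap : (n : ℕ) → Map n
idMap n = allFin n

_∘M_ : ∀ {n} → Map n → Map n → Map n
σ ∘M τ = tabulate (λ x → app σ (app τ x))

-- a map Fin n → Fin n is a permutation iff it is injective (X finite)
IsPerm : ∀ {n} → Map n → Set
IsPerm {n} σ = ∀ (x y : Fin n) → app σ x ≡ app σ y → x ≡ y

-- all maps X → X (the sums over G range over those in G)
allMaps : (n : ℕ) → List (Map n)
allMaps n = allVecs (allFinList n) n

record Subgroup (n : ℕ) : Set₁ where
  field
    mem      : Map n → Set
    mem?     : Decidable mem
    mem⇒perm : ∀ {σ} → mem σ → IsPerm σ
    id∈      : mem (idMap n)
    ∘∈       : ∀ {σ τ} → mem σ → mem τ → mem (σ ∘M τ)
    inv∈     : ∀ {σ} → mem σ → Σ (Map n) (λ τ → mem τ × (σ ∘M τ ≡ idMap n))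

iter : ∀ {n} → Map n → ℕ → Fin n → Fin n
iter σ zero    x = x
iter σ (suc j) x = app σ (iter σ j x)

-- least j in the list with σ^j x = x (0 if none)
firstReturn : ∀ {n} → Map n → Fin n → List ℕ → ℕ
firstReturn σ x []       = 0
firstReturn σ x (j ∷ js) with FinP._≟_ (iter σ j x) x
... | yes _ = j
... | no  _ = firstReturn σ x js

cycLen : ∀ {n} → Map n → Fin n → ℕ
cycLen {n} σ x = firstReturn σ x (map suc (upTo n))

-- c_i(σ) for i ≥ 1 (argument i is i = suc i′): the elements lying in
-- cycles of length i number i·c_i(σ)
cyc : ∀ {n} → (i : ℕ) → Map n → ℕ
cyc {n} zero    σ = 0
cyc {n} (suc i) σ =
  length (filter (λ x → cycLen σ x ≟ suc i) (allFinList n)) / suc i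

sumV : ∀ {m} → Vec ℕ m → ℕ
sumV []       = 0
sumV (k ∷ ks) = k +ℕ sumV ks

compositions : (m n : ℕ) → List (Vec ℕ m)
compositions m n = filter (λ k → sumV k ≟ n) (allVecs (upTo (suc n)) m)

Disjoint2 : ∀ {n} → Subset n → Subset n → Set
Disjoint2 {n} A B = ∀ (x : Fin n) → x ∈ A → ¬ (x ∈ B)

disjoint2? : ∀ {n} (A B : Subset n) → Dec (Disjoint2 A B)
disjoint2? A B = all? (λ x → (x ∈? A) →-dec ¬? (x ∈? B))

IsBlockTuple : ∀ {n m} → Vec ℕ m → Vec (Subset n) m → Set
IsBlockTuple {n} {m} k α =
  (∀ (i j : Fin m) → ¬ (i ≡ j) → Disjoint2 (lookup α i) (lookup α j))
  × (∀ (i : Fin m) → ∣ lookup α i ∣ ≡ lookup k i)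

isBlockTuple? : ∀ {n m} (k : Vec ℕ m) (α : Vec (Subset n) m) → Dec (IsBlockTuple k α)
isBlockTuple? k α =
  all? (λ i → all? (λ j → ¬? (i FinP.≟ j) →-dec disjoint2? (lookup α i) (lookup α j)))
  ×-dec all? (λ i → ∣ lookup α i ∣ ≟ lookup k i)

allSubsets : (n : ℕ) → List (Subset n)
allSubsets n = allVecs (true ∷ false ∷ []) n

blockTuples : ∀ {m} (n : ℕ) → Vec ℕ m → List (Vec (Subset n) m)
blockTuples {m} n k = filter (isBlockTuple? k) (allVecs (allSubsets n) m)

-- σ ∈ Sym(α) = Sym(A_1) × ⋯ × Sym(A_m) ⊆ Sym(X): σ maps each A_i into A_i
-- (for a permutation σ and a partition α this means σ restricts to a
-- permutation of each block and fixes nothing else to care about)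
InSymα : ∀ {n m} → Map n → Vec (Subset n) m → Set
InSymα {n} {m} σ α = ∀ (i : Fin m) (x : Fin n) → x ∈ lookup α i → app σ x ∈ lookup α i

inSymα? : ∀ {n m} (σ : Map n) (α : Vec (Subset n) m) → Dec (InSymα σ α)
inSymα? σ α = all? (λ i → all? (λ x → (x ∈? lookup α i) →-dec (app σ x ∈? lookup α i)))

module _ {c ℓ} (F : CommutativeRing c ℓ) where
  open CommutativeRing F

  natMul : ℕ → Carrier → Carrier
  natMul zero    x = 0#
  natMul (suc k) x = x + natMul k x

  IsField : Set (c Level.⊔ ℓ)
  IsField = (¬ (1# ≈ 0#)) × (∀ x → ¬ (x ≈ 0#) → Σ Carrier (λ y → x * y ≈ 1#))

  CharZero : Set ℓ
  CharZero = ∀ (k : ℕ) → ¬ (natMul (suc k) 1# ≈ 0#)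

module PolyRing {c ℓ} (F : CommutativeRing c ℓ) (m : ℕ) where
  open CommutativeRing F

  sumF : List Carrier → Carrier
  sumF = foldr _+_ 0#

  -- exponent vectors and polynomials, represented by their coefficients
  Exp : Set
  Exp = Vec ℕ m

  Poly : Set c
  Poly = Exp → Carrier

  coeff : Poly → Exp → Carrier
  coeff p e = p e

  _≈P_ : Poly → Poly → Set ℓ
  p ≈P q = ∀ (e : Exp) → coeff p e ≈ coeff q e

  0P : Poly
  0P e = 0#

  _+P_ : Poly → Poly → Poly
  (p +P q) e = p e + q e

  _·P_ : Carrier → Poly → Poly
  (a ·P p) e = a * p e

  mono : Exp → Poly
  mono k e with VecP.≡-dec _≟_ e k
  ... | yes _ = 1#
  ... | no  _ = 0#

  1P : Poly
  1P = mono (Data.Vec.replicate m 0)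

  var : Fin m → Poly
  var i = mono (tabulate (λ j → if ⌊ i FinP.≟ j ⌋ then 1 else 0))

  below : ∀ {k} → Vec ℕ k → List (Vec ℕ k)
  below []       = [] ∷ []
  below (e ∷ es) = concatMap (λ d → map (d ∷_) (below es)) (upTo (suc e))

  _*P_ : Poly → Poly → Poly
  (p *P q) e = sumF (map (λ d → p d * q (zipWith _∸_ e d)) (below e))

  _^P_ : Poly → ℕ → Poly
  p ^P zero  = 1P
  p ^P suc k = p *P (p ^P k)

  sumP : List Poly → Poly
  sumP = foldr _+P_ 0P

  prodP : List Poly → Poly
  prodP = foldr _*P_ 1P

  powerSum : ℕ → Poly
  powerSum j = sumP (map (λ i → var i ^P j) (allFinList m))

  -- Z(σ, t) = t_1^{c_1(σ)} ⋯ t_n^{c_n(σ)}   (t indexed from 1)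
  Z : ∀ {n} → Map n → (ℕ → Poly) → Poly
  Z {n} σ t = prodP (map (λ i → t i ^P cyc i σ) (map suc (upTo n)))

  when : ∀ {p} {P : Set p} → Dec P → (P → Carrier) → Carrier
  when (yes x) f = f x
  when (no _)  f = 0#

  module _ {n : ℕ} (G : Subgroup n) (Δ : (σ : Map n) → Subgroup.mem G σ → Carrier) where
    open Subgroup G

    innerSum : Vec (Subset n) m → Carrier
    innerSum α = sumF (map (λ σ → when (mem? σ) (λ g → when (inSymα? σ α) (λ _ → Δ σ g)))
                           (allMaps n))

    LHS : Poly
    LHS = sumP (map (λ k → sumF (map innerSum (blockTuples n k)) ·P mono k)
                    (compositions m n))

    RHS : Poly
    RHS = sumP (map (λ σ → when (mem? σ) (λ g → Δ σ g) ·P Z σ powerSum) (allMaps n))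

-- Exchanging the order of summation turns both sides into sums over σ ∈ G of Δ(σ) times a polynomial,
-- so it suffices to show, for each permutation σ, that Σ_k Σ_{α ∈ k(X), σ ∈ Sym(α)} w^(k) = Z(σ, w̃).
-- A tuple α with σ ∈ Sym(α) is the tuple of colour classes of a colouring X → [m] that is constant on
-- the cycles of σ, and k is the content of that colouring. Colouring the cycles one at a time, a cycle
-- of length ℓ can take any colour i and contributes w_i^ℓ, i.e. a factor Σ_i w_i^ℓ = w̃_ℓ; hence the
-- generating function of these colourings is ∏_ℓ w̃_ℓ^(c_ℓ(σ)) = Z(σ, w̃). Polynomials with natural
-- coefficients are represented by lists of exponent vectors, so these identities become permutation
-- equivalences of lists.

module Submission where

open import Defs
open import Level using (Level)
open import Function using (_∘_; case_of_)
open import Function.Bundles using (mk⇔; Equivalence)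
open import Data.Empty using (⊥-elim)
open import Data.Sum using (inj₁; inj₂)
open import Data.Product using (∃; _×_; _,_; proj₁; proj₂)
open import Data.Product.Properties using (,-injective)
open import Data.Bool as Bool using (Bool; true; false; _∧_; not; if_then_else_)
import Data.Bool.Properties as Boolₚ
open import Data.Nat as ℕ using (ℕ; zero; suc; _≤_; _<_; _∸_; _/_; s≤s; z≤n) renaming (_+_ to _+ℕ_; _*_ to _*ℕ_)
import Data.Nat.Properties as ℕₚ
import Data.Nat.DivMod as ℕ÷
open import Data.Fin as Fin using (Fin)
import Data.Fin.Properties as Finₚ
open import Data.Fin.Properties using (_≟_)
import Data.Fin.Subset as Sub
open import Data.Fin.Subset using (Subset)
open import Data.Vec as Vec using (Vec; []; _∷_; lookup; tabulate; zipWith)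
import Data.Vec.Properties as Vecₚ
open import Data.Vec.Relation.Binary.Pointwise.Inductive as Pointwise using (Pointwise; []; _∷_)
open import Data.List as List using (List; []; _∷_; map; _++_; concatMap; filter; foldr; upTo; length)
import Data.List.Properties as Listₚ
open import Data.List.Membership.Propositional using (_∈_; _∉_; find; lose)
import Data.List.Membership.Propositional.Properties as ∈ₚ
open import Data.List.Membership.Propositional.Properties.WithK using (unique∧set⇒bag)
open import Data.List.Relation.Unary.Any using (here; there; any?)
import Data.List.Relation.Unary.All as All
import Data.List.Relation.Unary.All.Properties as Allₚ
open import Data.List.Relation.Unary.AllPairs using ([]; _∷_)
open import Data.List.Relation.Unary.Unique.Propositional using (Unique)
import Data.List.Relation.Unary.Unique.Propositional.Properties as Uniqueₚ
open import Data.List.Relation.Binary.Permutation.Propositional as ↭ using (_↭_; ↭-refl; ↭-sym; ↭-trans; ↭-reflexive; prep; swap)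
import Data.List.Relation.Binary.Permutation.Propositional.Properties as ↭ₚ
open import Data.List.Relation.Binary.BagAndSetEquality using (∼bag⇒↭)
open import Relation.Binary.PropositionalEquality using (_≡_; _≢_; refl; sym; trans; cong; cong₂; subst; module ≡-Reasoning)
open import Relation.Binary.Definitions using (tri<; tri≈; tri>)
open import Relation.Nullary using (Dec; yes; no; does)
open import Relation.Nullary.Decidable using (⌊_⌋; isYes≗does; T?; _×-dec_; _→-dec_; dec-true; dec-false)
open import Algebra.Bundles using (CommutativeRing; CommutativeMonoid)
import Algebra.Properties.CommutativeSemigroup as CommSemigroupₚ
open import Algebra.Properties.CommutativeMonoid.Sum ℕₚ.+-0-commutativeMonoid using (sum; ∑-distrib-+; ∑-comm; sum-cong-≋; sum-replicate-zero)

-- Permutations and enumerations of lists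

module _ {A B : Set} where

  InjectiveOn : List A → (A → B) → Set
  InjectiveOn xs h = ∀ {x y} → x ∈ xs → y ∈ xs → h x ≡ h y → x ≡ y

  Unique-map-injectiveOn : ∀ (h : A → B) {xs} → Unique xs → InjectiveOn xs h → Unique (map h xs)
  Unique-map-injectiveOn h []         inj = []
  Unique-map-injectiveOn h (x∉ ∷ uxs) inj =
    Allₚ.map⁺ (All.tabulate λ y∈ hx≡hy → All.lookup x∉ y∈ (inj (here refl) (there y∈) hx≡hy))
    ∷ Unique-map-injectiveOn h uxs (λ x∈ y∈ → inj (there x∈) (there y∈))

  map-↭-bijectiveOn : ∀ (h : A → B) {xs ys} → Unique xs → Unique ys → InjectiveOn xs h →
    (∀ {x} → x ∈ xs → h x ∈ ys) → (∀ {y} → y ∈ ys → ∃ λ x → x ∈ xs × h x ≡ y) →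
    map h xs ↭ ys
  map-↭-bijectiveOn h uxs uys inj into onto =
    ∼bag⇒↭ (unique∧set⇒bag (Unique-map-injectiveOn h uxs inj) uys (mk⇔ to from))
    where
    to : ∀ {y} → y ∈ map h _ → y ∈ _
    to y∈ with ∈ₚ.∈-map⁻ h y∈
    ... | x , x∈ , refl = into x∈
    from : ∀ {y} → y ∈ _ → y ∈ map h _
    from y∈ with onto y∈
    ... | x , x∈ , refl = ∈ₚ.∈-map⁺ h x∈

  concatMap-↭ : ∀ (f : A → List B) {xs ys} → xs ↭ ys → concatMap f xs ↭ concatMap f ys
  concatMap-↭ f ↭.refl        = ↭-refl
  concatMap-↭ f (prep x p)    = ↭ₚ.++⁺ˡ (f x) (concatMap-↭ f p)
  concatMap-↭ f (swap x y p)  =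
    ↭-trans (↭ₚ.shifts (f x) (f y)) (↭ₚ.++⁺ˡ (f y) (↭ₚ.++⁺ˡ (f x) (concatMap-↭ f p)))
  concatMap-↭ f (↭.trans p q) = ↭-trans (concatMap-↭ f p) (concatMap-↭ f q)

  concatMap-cong-↭ : ∀ {f g : A → List B} → (∀ x → f x ↭ g x) →
                     ∀ xs → concatMap f xs ↭ concatMap g xs
  concatMap-cong-↭ f↭g []       = ↭-refl
  concatMap-cong-↭ f↭g (x ∷ xs) = ↭ₚ.++⁺ (f↭g x) (concatMap-cong-↭ f↭g xs)

concatMap-concatMap : ∀ {A B C : Set} (f : B → List C) (g : A → List B) xs →
  concatMap f (concatMap g xs) ≡ concatMap (concatMap f ∘ g) xs
concatMap-concatMap f g []       = refl
concatMap-concatMap f g (x ∷ xs) =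
  trans (Listₚ.concatMap-++ f (g x) (concatMap g xs))
        (cong (concatMap f (g x) ++_) (concatMap-concatMap f g xs))

concatMap-map-comm : ∀ {A B C : Set} (f : A → B → C) xs ys →
  concatMap (λ x → map (f x) ys) xs ↭ concatMap (λ y → map (λ x → f x y) xs) ys
concatMap-map-comm f []       ys = ↭-reflexive (sym (concatMap-nil ys))
  where
  concatMap-nil : ∀ ys → concatMap (λ y → map (λ x → f x y) []) ys ≡ []
  concatMap-nil []       = refl
  concatMap-nil (_ ∷ ys) = concatMap-nil ys
concatMap-map-comm f (x ∷ xs) ys =
  ↭-trans (↭ₚ.++⁺ˡ (map (f x) ys) (concatMap-map-comm f xs ys)) (interleave ys)
  where
  interleave : ∀ ys → map (f x) ys ++ concatMap (λ y → map (λ x → f x y) xs) ys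
                      ↭ concatMap (λ y → map (λ x → f x y) (x ∷ xs)) ys
  interleave []       = ↭-refl
  interleave (y ∷ ys) = prep (f x y)
    (↭-trans (↭ₚ.shifts (map (f x) ys) (map (λ x → f x y) xs)) (↭ₚ.++⁺ˡ _ (interleave ys)))

module _ {A B C : Set} (f : A → B → C) (G : A → List B) where

  ∈-concatMap-map⁺ : ∀ {as a b} → a ∈ as → b ∈ G a →
                     f a b ∈ concatMap (λ a → map (f a) (G a)) as
  ∈-concatMap-map⁺ a∈ b∈ =
    ∈ₚ.∈-concatMap⁺ (λ a → map (f a) (G a)) (lose a∈ (∈ₚ.∈-map⁺ (f _) b∈))

  ∈-concatMap-map⁻ : ∀ as {c} → c ∈ concatMap (λ a → map (f a) (G a)) as →
    ∃ λ a → ∃ λ b → a ∈ as × b ∈ G a × c ≡ f a b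
  ∈-concatMap-map⁻ as c∈ with find (∈ₚ.∈-concatMap⁻ (λ a → map (f a) (G a)) {xs = as} c∈)
  ... | a , a∈ , c∈′ with ∈ₚ.∈-map⁻ (f a) c∈′
  ...   | b , b∈ , c≡ = a , b , a∈ , b∈ , c≡

  Unique-concatMap-map⁺ : (∀ {a a′ b b′} → f a b ≡ f a′ b′ → a ≡ a′ × b ≡ b′) →
    ∀ {as} → Unique as → (∀ a → Unique (G a)) →
    Unique (concatMap (λ a → map (f a) (G a)) as)
  Unique-concatMap-map⁺ f-inj []          uG = []
  Unique-concatMap-map⁺ f-inj {a ∷ as} (a∉ ∷ uas) uG =
    Uniqueₚ.++⁺ (Uniqueₚ.map⁺ (proj₂ ∘ f-inj) (uG a))
                (Unique-concatMap-map⁺ f-inj uas uG) disjoint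
    where
    disjoint : ∀ {c} → c ∈ map (f a) (G a) × c ∈ concatMap (λ a → map (f a) (G a)) as → _
    disjoint (c∈ , c∈′) with ∈ₚ.∈-map⁻ (f a) c∈ | ∈-concatMap-map⁻ as c∈′
    ... | b , _ , refl | a′ , b′ , a′∈ , _ , c≡ = All.lookup a∉ a′∈ (proj₁ (f-inj c≡))

allVecs-∈ : ∀ {A : Set} {xs : List A} {k} (v : Vec A k) →
            (∀ i → lookup v i ∈ xs) → v ∈ allVecs xs k
allVecs-∈ []      v∈ = here refl
allVecs-∈ (a ∷ v) v∈ = ∈-concatMap-map⁺ _∷_ _ (v∈ Fin.zero) (allVecs-∈ v (v∈ ∘ Fin.suc))

Unique-allVecs : ∀ {A : Set} {xs : List A} → Unique xs → ∀ k → Unique (allVecs xs k)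
Unique-allVecs uxs zero    = All.[] ∷ []
Unique-allVecs uxs (suc k) =
  Unique-concatMap-map⁺ _∷_ _ Vecₚ.∷-injective uxs (λ _ → Unique-allVecs uxs k)

dependentPairs : ∀ {A B : Set} → List A → (A → List B) → List (A × B)
dependentPairs as G = concatMap (λ a → map (a ,_) (G a)) as

lookup-ext : ∀ {A : Set} {k} {u v : Vec A k} → (∀ i → lookup u i ≡ lookup v i) → u ≡ v
lookup-ext {u = u} {v} u≗v =
  trans (sym (Vecₚ.tabulate∘lookup u)) (trans (Vecₚ.tabulate-cong u≗v) (Vecₚ.tabulate∘lookup v))

toList-tabulate : ∀ {A : Set} {n} (f : Fin n → A) → Vec.toList (tabulate f) ≡ List.tabulate f
toList-tabulate {n = zero}  f = refl
toList-tabulate {n = suc n} f = cong (f Fin.zero ∷_) (toList-tabulate (f ∘ Fin.suc))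

allFinList-∈ : ∀ {n} (x : Fin n) → x ∈ allFinList n
allFinList-∈ x = subst (x ∈_) (sym (toList-tabulate (λ x → x))) (∈ₚ.∈-allFin x)

Unique-allFinList : ∀ n → Unique (allFinList n)
Unique-allFinList n = subst Unique (sym (toList-tabulate (λ x → x))) (Uniqueₚ.allFin⁺ n)

-- Polynomials with natural coefficients as lists of exponent vectors

𝟙 : Bool → ℕ
𝟙 b = if b then 1 else 0

module ExponentLists (m : ℕ) where

  _+v_ : ∀ {k} → Vec ℕ k → Vec ℕ k → Vec ℕ k
  _+v_ = zipWith _+ℕ_

  0v : Vec ℕ m
  0v = Vec.replicate m 0

  +v-comm : ∀ {k} (a b : Vec ℕ k) → a +v b ≡ b +v a
  +v-comm []      []      = refl
  +v-comm (x ∷ a) (y ∷ b) = cong₂ _∷_ (ℕₚ.+-comm x y) (+v-comm a b)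

  +v-assoc : ∀ {k} (a b c : Vec ℕ k) → (a +v b) +v c ≡ a +v (b +v c)
  +v-assoc []      []      []      = refl
  +v-assoc (x ∷ a) (y ∷ b) (z ∷ c) = cong₂ _∷_ (ℕₚ.+-assoc x y z) (+v-assoc a b c)

  +v-identityˡ : ∀ {k} (a : Vec ℕ k) → Vec.replicate k 0 +v a ≡ a
  +v-identityˡ []      = refl
  +v-identityˡ (x ∷ a) = cong (x ∷_) (+v-identityˡ a)

  ≤-+v : ∀ {k} (a b : Vec ℕ k) → Pointwise _≤_ a (a +v b)
  ≤-+v []      []      = []
  ≤-+v (x ∷ a) (y ∷ b) = ℕₚ.m≤m+n x y ∷ ≤-+v a b

  +v-∸-cancelˡ : ∀ {k} (a b : Vec ℕ k) → zipWith _∸_ (a +v b) a ≡ b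
  +v-∸-cancelˡ []      []      = refl
  +v-∸-cancelˡ (x ∷ a) (y ∷ b) = cong₂ _∷_ (ℕₚ.m+n∸m≡n x y) (+v-∸-cancelˡ a b)

  +v-∸-inverse : ∀ {k} {a e : Vec ℕ k} → Pointwise _≤_ a e → a +v zipWith _∸_ e a ≡ e
  +v-∸-inverse []              = refl
  +v-∸-inverse (x≤y ∷ a≤e) = cong₂ _∷_ (ℕₚ.m+[n∸m]≡n x≤y) (+v-∸-inverse a≤e)

  -- A list L of exponent vectors stands for the polynomial Σ_{a ∈ L} wᵃ with natural coefficients
  -- (⟦ L ⟧ below); _⊗_ is the product of such polynomials.
  infixr 7 _⊗_
  _⊗_ : List (Vec ℕ m) → List (Vec ℕ m) → List (Vec ℕ m)
  L ⊗ M = concatMap (λ a → map (a +v_) M) L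

  ⨂ : List (List (Vec ℕ m)) → List (Vec ℕ m)
  ⨂ = foldr _⊗_ (0v ∷ [])

  _^⊗_ : List (Vec ℕ m) → ℕ → List (Vec ℕ m)
  L ^⊗ zero  = 0v ∷ []
  L ^⊗ suc k = L ⊗ (L ^⊗ k)

  ⊗-comm : ∀ L M → L ⊗ M ↭ M ⊗ L
  ⊗-comm L M = ↭-trans (concatMap-map-comm _+v_ L M)
    (concatMap-cong-↭ (λ b → ↭-reflexive (Listₚ.map-cong (λ a → +v-comm a b) L)) M)

  ⊗-congˡ : ∀ {L L′} M → L ↭ L′ → L ⊗ M ↭ L′ ⊗ M
  ⊗-congˡ M = concatMap-↭ _

  ⊗-congʳ : ∀ L {M M′} → M ↭ M′ → L ⊗ M ↭ L ⊗ M′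
  ⊗-congʳ L M↭M′ = concatMap-cong-↭ (λ a → ↭ₚ.map⁺ (a +v_) M↭M′) L

  ⊗-assoc : ∀ L M N → (L ⊗ M) ⊗ N ≡ L ⊗ (M ⊗ N)
  ⊗-assoc L M N = begin
    concatMap (λ c → map (c +v_) N) (concatMap (λ a → map (a +v_) M) L)
      ≡⟨ concatMap-concatMap (λ c → map (c +v_) N) (λ a → map (a +v_) M) L ⟩
    concatMap (λ a → concatMap (λ c → map (c +v_) N) (map (a +v_) M)) L
      ≡⟨ Listₚ.concatMap-cong (λ a → Listₚ.concatMap-map (λ c → map (c +v_) N) (a +v_) M) L ⟩
    concatMap (λ a → concatMap (λ b → map ((a +v b) +v_) N) M) L
      ≡⟨ Listₚ.concatMap-cong (λ a → Listₚ.concatMap-cong (λ b →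
           trans (Listₚ.map-cong (+v-assoc a b) N) (Listₚ.map-∘ N)) M) L ⟩
    concatMap (λ a → concatMap (λ b → map (a +v_) (map (b +v_) N)) M) L
      ≡⟨ Listₚ.concatMap-cong (λ a → Listₚ.map-concatMap (a +v_) (λ b → map (b +v_) N) M) L ⟨
    concatMap (λ a → map (a +v_) (M ⊗ N)) L ∎
    where open ≡-Reasoning

  ⊗-identityˡ : ∀ L → (0v ∷ []) ⊗ L ≡ L
  ⊗-identityˡ L =
    trans (Listₚ.++-identityʳ _) (trans (Listₚ.map-cong +v-identityˡ L) (Listₚ.map-id L))

  ⊗-leftComm : ∀ L M N → L ⊗ (M ⊗ N) ↭ M ⊗ (L ⊗ N)
  ⊗-leftComm L M N = ↭-trans (↭-reflexive (sym (⊗-assoc L M N)))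
    (↭-trans (⊗-congˡ N (⊗-comm L M)) (↭-reflexive (⊗-assoc M L N)))

  ⨂-ones : ∀ {A : Set} (G : A → List (Vec ℕ m)) → (∀ i → G i ≡ 0v ∷ []) →
           ∀ is → ⨂ (map G is) ≡ 0v ∷ []
  ⨂-ones G G≡1 []       = refl
  ⨂-ones G G≡1 (i ∷ is) rewrite G≡1 i | ⨂-ones G G≡1 is = ⊗-identityˡ (0v ∷ [])

  ⨂-update : ∀ (is : List ℕ) (G G′ : ℕ → List (Vec ℕ m)) P l → Unique is → l ∈ is →
    (∀ i → i ≢ l → G′ i ≡ G i) → G′ l ≡ P ⊗ G l →
    ⨂ (map G′ is) ↭ P ⊗ ⨂ (map G is)
  ⨂-update (i ∷ is) G G′ P l (i∉ ∷ uis) l∈ G′≡G G′l≡ with i ℕ.≟ l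
  ... | yes refl = ↭-reflexive (trans (cong₂ _⊗_ G′l≡ (cong ⨂ (Listₚ.map-cong-local G′≡G-on-is)))
                                      (⊗-assoc P (G i) _))
    where
    G′≡G-on-is : All.All (λ j → G′ j ≡ G j) is
    G′≡G-on-is = All.tabulate λ {j} j∈ → G′≡G j λ { refl → All.lookup i∉ j∈ refl }
  ... | no i≢l with l∈
  ...   | here l≡i   = ⊥-elim (i≢l (sym l≡i))
  ...   | there l∈′ = begin
    G′ i ⊗ ⨂ (map G′ is)    ≡⟨ cong (_⊗ ⨂ (map G′ is)) (G′≡G i i≢l) ⟩
    G i ⊗ ⨂ (map G′ is)     ↭⟨ ⊗-congʳ (G i) (⨂-update is G G′ P l uis l∈′ G′≡G G′l≡) ⟩
    G i ⊗ P ⊗ ⨂ (map G is)  ↭⟨ ⊗-leftComm (G i) P _ ⟩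
    P ⊗ G i ⊗ ⨂ (map G is)  ∎
    where open ↭.PermutationReasoning

  unitExp : Fin m → Vec ℕ m
  unitExp i = tabulate (λ j → 𝟙 ⌊ i ≟ j ⌋)

  powerExp : Fin m → ℕ → Vec ℕ m
  powerExp i zero    = 0v
  powerExp i (suc j) = unitExp i +v powerExp i j

  lookup-powerExp : ∀ c j i → lookup (powerExp c j) i ≡ j *ℕ 𝟙 (does (c ≟ i))
  lookup-powerExp c zero    i = Vecₚ.lookup-replicate i 0
  lookup-powerExp c (suc j) i = trans (Vecₚ.lookup-zipWith _+ℕ_ i (unitExp c) (powerExp c j))
    (cong₂ _+ℕ_ (trans (Vecₚ.lookup∘tabulate _ i) (cong 𝟙 (isYes≗does (c ≟ i))))
                (lookup-powerExp c j i))

  singleton-^⊗ : ∀ i j → (unitExp i ∷ []) ^⊗ j ≡ powerExp i j ∷ []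
  singleton-^⊗ i zero    = refl
  singleton-^⊗ i (suc j) rewrite singleton-^⊗ i j = refl

  powerSumExps : ℕ → List (Vec ℕ m)
  powerSumExps j = map (λ i → powerExp i j) (allFinList m)

  cycleIndexExps : ∀ {n} → Map n → List (Vec ℕ m)
  cycleIndexExps {n} σ = ⨂ (map (λ i → powerSumExps i ^⊗ cyc i σ) (map suc (upTo n)))

-- Finite sums and the polynomial ring

module FiniteSums {c ℓ} (F : CommutativeRing c ℓ) where
  open CommutativeRing F
    renaming (refl to ≈-refl; sym to ≈-sym; trans to ≈-trans; reflexive to ≈-reflexive)
  open CommSemigroupₚ (CommutativeMonoid.commutativeSemigroup +-commutativeMonoid) using (interchange)

  Σ[_] : ∀ {A : Set} → (A → Carrier) → List A → Carrier
  Σ[ f ] xs = foldr _+_ 0# (map f xs)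

  module _ {A : Set} where

    Σ-cong : ∀ {f g : A → Carrier} → (∀ x → f x ≈ g x) → ∀ xs → Σ[ f ] xs ≈ Σ[ g ] xs
    Σ-cong f≈g []       = ≈-refl
    Σ-cong f≈g (x ∷ xs) = +-cong (f≈g x) (Σ-cong f≈g xs)

    Σ-zero : ∀ {f : A → Carrier} → (∀ x → f x ≈ 0#) → ∀ xs → Σ[ f ] xs ≈ 0#
    Σ-zero f≈0 []       = ≈-refl
    Σ-zero f≈0 (x ∷ xs) = ≈-trans (+-cong (f≈0 x) (Σ-zero f≈0 xs)) (+-identityˡ 0#)

    Σ-distrib-+ : ∀ (f g : A → Carrier) xs → Σ[ (λ x → f x + g x) ] xs ≈ Σ[ f ] xs + Σ[ g ] xs
    Σ-distrib-+ f g []       = ≈-sym (+-identityˡ 0#)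
    Σ-distrib-+ f g (x ∷ xs) = ≈-trans (+-congˡ (Σ-distrib-+ f g xs)) (interchange _ _ _ _)

    Σ-distribˡ : ∀ a (f : A → Carrier) xs → Σ[ (λ x → a * f x) ] xs ≈ a * Σ[ f ] xs
    Σ-distribˡ a f []       = ≈-sym (zeroʳ a)
    Σ-distribˡ a f (x ∷ xs) = ≈-trans (+-congˡ (Σ-distribˡ a f xs)) (≈-sym (distribˡ a _ _))

    Σ-distribʳ : ∀ a (f : A → Carrier) xs → Σ[ (λ x → f x * a) ] xs ≈ Σ[ f ] xs * a
    Σ-distribʳ a f []       = ≈-sym (zeroˡ a)
    Σ-distribʳ a f (x ∷ xs) = ≈-trans (+-congˡ (Σ-distribʳ a f xs)) (≈-sym (distribʳ a _ _))

    Σ-++ : ∀ (f : A → Carrier) xs ys → Σ[ f ] (xs ++ ys) ≈ Σ[ f ] xs + Σ[ f ] ys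
    Σ-++ f []       ys = ≈-sym (+-identityˡ _)
    Σ-++ f (x ∷ xs) ys = ≈-trans (+-congˡ (Σ-++ f xs ys)) (≈-sym (+-assoc _ _ _))

    Σ-↭ : ∀ (f : A → Carrier) {xs ys} → xs ↭ ys → Σ[ f ] xs ≈ Σ[ f ] ys
    Σ-↭ f ↭.refl        = ≈-refl
    Σ-↭ f (prep x p)    = +-congˡ (Σ-↭ f p)
    Σ-↭ f (swap x y p)  = ≈-trans (≈-sym (+-assoc _ _ _))
      (≈-trans (+-congʳ (+-comm _ _)) (≈-trans (+-assoc _ _ _) (+-congˡ (+-congˡ (Σ-↭ f p)))))
    Σ-↭ f (↭.trans p q) = ≈-trans (Σ-↭ f p) (Σ-↭ f q)

  Σ-comm : ∀ {A B : Set} (f : A → B → Carrier) xs ys →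
    Σ[ (λ x → Σ[ f x ] ys) ] xs ≈ Σ[ (λ y → Σ[ (λ x → f x y) ] xs) ] ys
  Σ-comm f []       ys = ≈-sym (Σ-zero (λ _ → ≈-refl) ys)
  Σ-comm f (x ∷ xs) ys = ≈-trans (+-congˡ (Σ-comm f xs ys)) (≈-sym (Σ-distrib-+ (f x) _ ys))

  Σ-concatMap : ∀ {A B : Set} (f : B → Carrier) (g : A → List B) xs →
    Σ[ f ] (concatMap g xs) ≈ Σ[ (λ x → Σ[ f ] (g x)) ] xs
  Σ-concatMap f g []       = ≈-refl
  Σ-concatMap f g (x ∷ xs) = ≈-trans (Σ-++ f (g x) (concatMap g xs)) (+-congˡ (Σ-concatMap f g xs))

  Σ-map : ∀ {A B : Set} (f : B → Carrier) (g : A → B) xs → Σ[ f ] (map g xs) ≡ Σ[ f ∘ g ] xs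
  Σ-map f g xs = cong (foldr _+_ 0#) (sym (Listₚ.map-∘ xs))

  Σ-dependentPairs : ∀ {A B : Set} (f : A × B → Carrier) as (G : A → List B) →
    Σ[ f ] (dependentPairs as G) ≈ Σ[ (λ a → Σ[ (λ b → f (a , b)) ] (G a)) ] as
  Σ-dependentPairs f as G = ≈-trans (Σ-concatMap f (λ a → map (a ,_) (G a)) as)
    (Σ-cong (λ a → ≈-reflexive (Σ-map f (a ,_) (G a))) as)

module Polynomials {c ℓ} (F : CommutativeRing c ℓ) (m : ℕ) where
  open CommutativeRing F
    renaming (refl to ≈-refl; sym to ≈-sym; trans to ≈-trans; reflexive to ≈-reflexive)
  open PolyRing F m
  open ExponentLists m
  open FiniteSums F public

  Σ-filter : ∀ {A : Set} {P : A → Set} (P? : ∀ x → Dec (P x)) (f : A → Carrier) xs →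
    Σ[ (λ x → when (P? x) (λ _ → 1#) * f x) ] xs ≈ Σ[ f ] (filter P? xs)
  Σ-filter P? f []       = ≈-refl
  Σ-filter P? f (x ∷ xs) with P? x
  ... | yes _ = +-cong (*-identityˡ (f x)) (Σ-filter P? f xs)
  ... | no  _ = ≈-trans (+-cong (zeroˡ (f x)) (Σ-filter P? f xs)) (+-identityˡ _)

  sumP-apply : ∀ {A : Set} (P : A → Poly) xs e → sumP (map P xs) e ≡ Σ[ (λ a → P a e) ] xs
  sumP-apply P []       e = refl
  sumP-apply P (a ∷ xs) e = cong (P a e +_) (sumP-apply P xs e)

  mono-≡ : ∀ a e → e ≡ a → mono a e ≈ 1#
  mono-≡ a e e≡a with Vecₚ.≡-dec ℕ._≟_ e a
  ... | yes _   = ≈-refl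
  ... | no  e≢a = ⊥-elim (e≢a e≡a)

  mono-≢ : ∀ a e → e ≢ a → mono a e ≈ 0#
  mono-≢ a e e≢a with Vecₚ.≡-dec ℕ._≟_ e a
  ... | yes e≡a = ⊥-elim (e≢a e≡a)
  ... | no  _   = ≈-refl

  mono-cong : ∀ {a e a′ e′} → (e ≡ a → e′ ≡ a′) → (e′ ≡ a′ → e ≡ a) →
              mono a e ≈ mono a′ e′
  mono-cong {a} {e} {a′} {e′} to from with Vecₚ.≡-dec ℕ._≟_ e a
  ... | yes e≡a = ≈-sym (mono-≡ a′ e′ (to e≡a))
  ... | no  e≢a = ≈-sym (mono-≢ a′ e′ (e≢a ∘ from))

  Σ-mono-∉ : ∀ (g : Exp → Carrier) {a} xs → a ∉ xs → Σ[ (λ d → mono a d * g d) ] xs ≈ 0#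
  Σ-mono-∉ g []       a∉ = ≈-refl
  Σ-mono-∉ g (x ∷ xs) a∉ = ≈-trans (+-cong (≈-trans (*-congʳ x≢a) (zeroˡ _)) (Σ-mono-∉ g xs (a∉ ∘ there)))
                                   (+-identityˡ 0#)
    where x≢a = mono-≢ _ x λ { refl → a∉ (here refl) }

  Σ-mono-∈ : ∀ (g : Exp → Carrier) {a xs} → Unique xs → a ∈ xs →
             Σ[ (λ d → mono a d * g d) ] xs ≈ g a
  Σ-mono-∈ g {a} (a∉ ∷ uxs) (here refl) = ≈-trans
    (+-cong (≈-trans (*-congʳ (mono-≡ a a refl)) (*-identityˡ _))
            (Σ-mono-∉ g _ (Uniqueₚ.Unique[x∷xs]⇒x∉xs (a∉ ∷ uxs))))
    (+-identityʳ _)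
  Σ-mono-∈ g {xs = x ∷ _} (x∉ ∷ uxs) (there a∈) = ≈-trans
    (+-cong (≈-trans (*-congʳ x≢a) (zeroˡ _)) (Σ-mono-∈ g uxs a∈))
    (+-identityˡ _)
    where x≢a = mono-≢ _ x λ { refl → All.lookup x∉ a∈ refl }

  ∈-below⁺ : ∀ {k} {a e : Vec ℕ k} → Pointwise _≤_ a e → a ∈ below e
  ∈-below⁺ []                          = here refl
  ∈-below⁺ {e = _ ∷ e} (x≤y ∷ a≤e) =
    ∈-concatMap-map⁺ _∷_ (λ _ → below e) (∈ₚ.∈-upTo⁺ (s≤s x≤y)) (∈-below⁺ a≤e)

  ∈-below⁻ : ∀ {k} {a} (e : Vec ℕ k) → a ∈ below e → Pointwise _≤_ a e
  ∈-below⁻ []       (here refl) = []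
  ∈-below⁻ (y ∷ e) a∈ with ∈-concatMap-map⁻ _∷_ (λ _ → below e) (upTo (suc y)) a∈
  ... | x , a′ , x∈ , a′∈ , refl = ℕₚ.≤-pred (∈ₚ.∈-upTo⁻ x∈) ∷ ∈-below⁻ e a′∈

  Unique-below : ∀ {k} (e : Vec ℕ k) → Unique (below e)
  Unique-below []      = All.[] ∷ []
  Unique-below (y ∷ e) =
    Unique-concatMap-map⁺ _∷_ _ Vecₚ.∷-injective (Uniqueₚ.upTo⁺ (suc y)) (λ _ → Unique-below e)

  -- mono a is the indicator of a, so only d = a survives in the convolution defining _*P_.
  mono-*P-mono : ∀ a b → (mono a *P mono b) ≈P mono (a +v b)
  mono-*P-mono a b e with Pointwise.decidable ℕ._≤?_ a e
  ... | yes a≤e = ≈-trans (Σ-mono-∈ g (Unique-below e) (∈-below⁺ a≤e))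
    (mono-cong (λ e∸a≡b → trans (sym (+v-∸-inverse a≤e)) (cong (a +v_) e∸a≡b))
               (λ e≡a+b → trans (cong (λ e → zipWith _∸_ e a) e≡a+b) (+v-∸-cancelˡ a b)))
    where g = λ d → mono b (zipWith _∸_ e d)
  ... | no a≰e = ≈-trans (Σ-mono-∉ (λ d → mono b (zipWith _∸_ e d)) (below e) (a≰e ∘ ∈-below⁻ e))
    (≈-sym (mono-≢ (a +v b) e λ e≡a+b → a≰e (subst (Pointwise _≤_ a) (sym e≡a+b) (≤-+v a b))))

  ≈P-sym : ∀ {p q} → p ≈P q → q ≈P p
  ≈P-sym p≈q e = ≈-sym (p≈q e)

  ≈P-trans : ∀ {p q r} → p ≈P q → q ≈P r → p ≈P r
  ≈P-trans p≈q q≈r e = ≈-trans (p≈q e) (q≈r e)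

  +P-cong : ∀ {p p′ q q′} → p ≈P p′ → q ≈P q′ → (p +P q) ≈P (p′ +P q′)
  +P-cong p≈p′ q≈q′ e = +-cong (p≈p′ e) (q≈q′ e)

  *P-cong : ∀ {p p′ q q′} → p ≈P p′ → q ≈P q′ → (p *P q) ≈P (p′ *P q′)
  *P-cong p≈p′ q≈q′ e = Σ-cong (λ d → *-cong (p≈p′ d) (q≈q′ _)) (below e)

  *P-distribˡ : ∀ r p q → (r *P (p +P q)) ≈P ((r *P p) +P (r *P q))
  *P-distribˡ r p q e = ≈-trans (Σ-cong (λ d → distribˡ _ _ _) (below e)) (Σ-distrib-+ _ _ (below e))

  *P-distribʳ : ∀ r p q → ((p +P q) *P r) ≈P ((p *P r) +P (q *P r))
  *P-distribʳ r p q e = ≈-trans (Σ-cong (λ d → distribʳ _ _ _) (below e)) (Σ-distrib-+ _ _ (below e))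

  *P-zeroˡ : ∀ r → (0P *P r) ≈P 0P
  *P-zeroˡ r e = Σ-zero (λ d → zeroˡ _) (below e)

  *P-zeroʳ : ∀ r → (r *P 0P) ≈P 0P
  *P-zeroʳ r e = Σ-zero (λ d → zeroʳ _) (below e)

  ⟦_⟧ : List Exp → Poly
  ⟦ L ⟧ e = Σ[ (λ a → mono a e) ] L

  ⟦⟧-↭ : ∀ {L M} → L ↭ M → ⟦ L ⟧ ≈P ⟦ M ⟧
  ⟦⟧-↭ L↭M e = Σ-↭ _ L↭M

  ⟦⟧-++ : ∀ L M → ⟦ L ++ M ⟧ ≈P (⟦ L ⟧ +P ⟦ M ⟧)
  ⟦⟧-++ L M e = Σ-++ _ L M

  mono-*P-⟦⟧ : ∀ a M → (mono a *P ⟦ M ⟧) ≈P ⟦ map (a +v_) M ⟧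
  mono-*P-⟦⟧ a []      = *P-zeroʳ (mono a)
  mono-*P-⟦⟧ a (b ∷ M) = ≈P-trans (*P-distribˡ (mono a) (mono b) ⟦ M ⟧)
    (+P-cong (mono-*P-mono a b) (mono-*P-⟦⟧ a M))

  ⟦⟧-⊗ : ∀ L M → (⟦ L ⟧ *P ⟦ M ⟧) ≈P ⟦ L ⊗ M ⟧
  ⟦⟧-⊗ []      M = *P-zeroˡ ⟦ M ⟧
  ⟦⟧-⊗ (a ∷ L) M = ≈P-trans (*P-distribʳ ⟦ M ⟧ (mono a) ⟦ L ⟧)
    (≈P-trans (+P-cong (mono-*P-⟦⟧ a M) (⟦⟧-⊗ L M))
              (≈P-sym (⟦⟧-++ (map (a +v_) M) (L ⊗ M))))

  1P≈⟦0v⟧ : 1P ≈P ⟦ 0v ∷ [] ⟧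
  1P≈⟦0v⟧ e = ≈-sym (+-identityʳ _)

  ⟦⟧-^⊗ : ∀ {p} L → p ≈P ⟦ L ⟧ → ∀ k → (p ^P k) ≈P ⟦ L ^⊗ k ⟧
  ⟦⟧-^⊗ L p≈ zero    = 1P≈⟦0v⟧
  ⟦⟧-^⊗ L p≈ (suc k) = ≈P-trans (*P-cong p≈ (⟦⟧-^⊗ L p≈ k)) (⟦⟧-⊗ L (L ^⊗ k))

  ⟦⟧-⨂ : ∀ {A : Set} (P : A → Poly) (Q : A → List Exp) → (∀ i → P i ≈P ⟦ Q i ⟧) →
    ∀ is → prodP (map P is) ≈P ⟦ ⨂ (map Q is) ⟧
  ⟦⟧-⨂ P Q P≈ []       = 1P≈⟦0v⟧
  ⟦⟧-⨂ P Q P≈ (i ∷ is) = ≈P-trans (*P-cong (P≈ i) (⟦⟧-⨂ P Q P≈ is)) (⟦⟧-⊗ (Q i) _)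

  ⟦⟧-concatMap : ∀ {A : Set} (P : A → Poly) (Q : A → List Exp) → (∀ i → P i ≈P ⟦ Q i ⟧) →
    ∀ is → sumP (map P is) ≈P ⟦ concatMap Q is ⟧
  ⟦⟧-concatMap P Q P≈ []       e = ≈-refl
  ⟦⟧-concatMap P Q P≈ (i ∷ is)   =
    ≈P-trans (+P-cong (P≈ i) (⟦⟧-concatMap P Q P≈ is)) (≈P-sym (⟦⟧-++ (Q i) _))

  powerSum≈⟦⟧ : ∀ j → powerSum j ≈P ⟦ powerSumExps j ⟧
  powerSum≈⟦⟧ j = ≈P-trans
    (⟦⟧-concatMap (λ i → var i ^P j) (λ i → powerExp i j ∷ []) var^j≈ (allFinList m))
    (λ e → ≈-reflexive (cong (λ L → ⟦ L ⟧ e) concatMap-singleton))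
    where
    var^j≈ : ∀ i → (var i ^P j) ≈P ⟦ powerExp i j ∷ [] ⟧
    var^j≈ i = ≈P-trans (⟦⟧-^⊗ (unitExp i ∷ []) (λ e → ≈-sym (+-identityʳ _)) j)
                        (λ e → ≈-reflexive (cong (λ L → ⟦ L ⟧ e) (singleton-^⊗ i j)))
    concatMap-singleton : concatMap (λ i → powerExp i j ∷ []) (allFinList m) ≡ powerSumExps j
    concatMap-singleton = trans (sym (Listₚ.concatMap-map List.[_] (λ i → powerExp i j) (allFinList m)))
                                (Listₚ.concatMap-pure (powerSumExps j))

  Z-powerSum≈⟦⟧ : ∀ {n} (σ : Map n) → Z σ powerSum ≈P ⟦ cycleIndexExps σ ⟧
  Z-powerSum≈⟦⟧ {n} σ = ⟦⟧-⨂ (λ i → powerSum i ^P cyc i σ) (λ i → powerSumExps i ^⊗ cyc i σ)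
    (λ i → ⟦⟧-^⊗ (powerSumExps i) (powerSum≈⟦⟧ i) (cyc i σ)) (map suc (upTo n))

-- Counting over Fin n

count : ∀ {n} → (Fin n → Bool) → ℕ
count p = sum (𝟙 ∘ p)

count-cong : ∀ {n} {p q : Fin n → Bool} → (∀ x → p x ≡ q x) → count p ≡ count q
count-cong p≗q = sum-cong-≋ (cong 𝟙 ∘ p≗q)

count-false : ∀ {n} (p : Fin n → Bool) → (∀ x → p x ≡ false) → count p ≡ 0
count-false {n} p p≗false = trans (count-cong p≗false) (sum-replicate-zero n)

count-split : ∀ {n} (p q : Fin n → Bool) →
              count p ≡ count (λ x → p x ∧ q x) +ℕ count (λ x → p x ∧ not (q x))
count-split p q = trans (sum-cong-≋ λ x → split (p x) (q x)) (∑-distrib-+ (λ x → 𝟙 (p x ∧ q x)) _)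
  where
  split : ∀ a b → 𝟙 a ≡ 𝟙 (a ∧ b) +ℕ 𝟙 (a ∧ not b)
  split true  true  = refl
  split true  false = refl
  split false b     = refl

sum-≤ : ∀ {n} (f : Fin n → ℕ) → (∀ x → f x ≤ 1) → sum f ≤ n
sum-≤ {zero}  f f≤1 = z≤n
sum-≤ {suc n} f f≤1 = ℕₚ.+-mono-≤ (f≤1 Fin.zero) (sum-≤ (f ∘ Fin.suc) (f≤1 ∘ Fin.suc))

𝟙≤1 : ∀ b → 𝟙 b ≤ 1
𝟙≤1 true  = s≤s z≤n
𝟙≤1 false = z≤n

count≤ : ∀ {n} (p : Fin n → Bool) → count p ≤ n
count≤ p = sum-≤ _ (𝟙≤1 ∘ p)

sum≡n⇒all≡1 : ∀ {n} (f : Fin n → ℕ) → (∀ x → f x ≤ 1) → sum f ≡ n → ∀ x → f x ≡ 1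
sum≡n⇒all≡1 {suc n} f f≤1 Σf≡n x with ℕₚ.n≤1⇒n≡0∨n≡1 (f≤1 Fin.zero)
... | inj₁ f₀≡0 = ⊥-elim (ℕₚ.<-irrefl refl (ℕₚ.≤-trans
        (ℕₚ.≤-reflexive (trans (sym Σf≡n) (cong (_+ℕ sum (f ∘ Fin.suc)) f₀≡0)))
        (sum-≤ (f ∘ Fin.suc) (f≤1 ∘ Fin.suc))))
sum≡n⇒all≡1 {suc n} f f≤1 Σf≡n Fin.zero    | inj₂ f₀≡1 = f₀≡1
sum≡n⇒all≡1 {suc n} f f≤1 Σf≡n (Fin.suc x) | inj₂ f₀≡1 =
  sum≡n⇒all≡1 (f ∘ Fin.suc) (f≤1 ∘ Fin.suc)
              (ℕₚ.+-cancelˡ-≡ 1 _ _ (trans (cong (_+ℕ sum (f ∘ Fin.suc)) (sym f₀≡1)) Σf≡n)) x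

sum-≥ : ∀ {n} (f : Fin n → ℕ) x → f x ≤ sum f
sum-≥ f Fin.zero    = ℕₚ.m≤m+n _ _
sum-≥ f (Fin.suc x) = ℕₚ.≤-trans (sum-≥ (f ∘ Fin.suc) x) (ℕₚ.m≤n+m _ _)

count-pos : ∀ {n} (p : Fin n → Bool) x → p x ≡ true → 1 ≤ count p
count-pos p x px = ℕₚ.≤-trans (ℕₚ.≤-reflexive (cong 𝟙 (sym px))) (sum-≥ _ x)

count≡0⇒false : ∀ {n} (p : Fin n → Bool) → count p ≡ 0 → ∀ x → p x ≡ false
count≡0⇒false p #p≡0 x with p x in px
... | false = refl
... | true  = ⊥-elim (ℕₚ.<-irrefl refl (ℕₚ.≤-trans (count-pos p x px) (ℕₚ.≤-reflexive #p≡0)))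

count-witness : ∀ {n} (p : Fin n → Bool) → 1 ≤ count p → ∃ λ x → p x ≡ true
count-witness {suc n} p 1≤#p with p Fin.zero in p₀
... | true  = Fin.zero , p₀
... | false with count-witness (p ∘ Fin.suc) 1≤#p
...   | x , px = Fin.suc x , px

count≤1 : ∀ {n} (p : Fin n → Bool) → (∀ x y → p x ≡ true → p y ≡ true → x ≡ y) →
          count p ≤ 1
count≤1 {zero}  p p-unique = z≤n
count≤1 {suc n} p p-unique with p Fin.zero in p₀
... | true  = ℕₚ.≤-reflexive (cong suc (count-false (p ∘ Fin.suc) rest-false))
  where
  rest-false : ∀ x → p (Fin.suc x) ≡ false
  rest-false x with p (Fin.suc x) in pₓ
  ... | false = refl
  ... | true with () ← p-unique Fin.zero (Fin.suc x) p₀ pₓ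
... | false = count≤1 (p ∘ Fin.suc) (λ x y px py → Finₚ.suc-injective (p-unique _ _ px py))

length-filter-tabulate : ∀ {n} {A : Set} {P : A → Set} (P? : (a : A) → Dec (P a)) (f : Fin n → A) →
  length (filter P? (Vec.toList (tabulate f))) ≡ count (λ x → does (P? (f x)))
length-filter-tabulate {zero}  P? f = refl
length-filter-tabulate {suc n} P? f with P? (f Fin.zero)
... | yes _ = cong suc (length-filter-tabulate P? (f ∘ Fin.suc))
... | no  _ = length-filter-tabulate P? (f ∘ Fin.suc)

∣∣≡count : ∀ {n} (s : Subset n) → Sub.∣ s ∣ ≡ count (lookup s)
∣∣≡count []          = refl
∣∣≡count (true ∷ s)  = cong suc (∣∣≡count s)
∣∣≡count (false ∷ s) = ∣∣≡count s

-- Cycles of a permutation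

range : ℕ → ℕ → List ℕ
range a zero    = []
range a (suc k) = a ∷ range (suc a) k

-- cycLen scans the list map suc (upTo n); as range 1 n it can be traversed by induction.
map-suc-upTo : ∀ n → map suc (upTo n) ≡ range 1 n
map-suc-upTo n = go n (λ i → i) 0 (λ i → refl)
  where
  go : ∀ k (f : ℕ → ℕ) a → (∀ i → f i ≡ a +ℕ i) → map suc (List.applyUpTo f k) ≡ range (suc a) k
  go zero    f a f≗a+ = refl
  go (suc k) f a f≗a+ = cong₂ _∷_ (cong suc (trans (f≗a+ 0) (ℕₚ.+-identityʳ a)))
    (go k (f ∘ suc) (suc a) (λ i → trans (f≗a+ (suc i)) (ℕₚ.+-suc a i)))

module Orbits {n : ℕ} (σ : Map n) (σ-perm : IsPerm σ) where

  σ^ : ℕ → Fin n → Fin n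
  σ^ = iter σ

  σ^-+ : ∀ a b x → σ^ (a +ℕ b) x ≡ σ^ a (σ^ b x)
  σ^-+ zero    b x = refl
  σ^-+ (suc a) b x = cong (app σ) (σ^-+ a b x)

  σ^-comm : ∀ a b x → σ^ a (σ^ b x) ≡ σ^ b (σ^ a x)
  σ^-comm a b x =
    trans (sym (σ^-+ a b x)) (trans (cong (λ k → σ^ k x) (ℕₚ.+-comm a b)) (σ^-+ b a x))

  σ^-injective : ∀ a {x y} → σ^ a x ≡ σ^ a y → x ≡ y
  σ^-injective zero    eq = eq
  σ^-injective (suc a) eq = σ^-injective a (σ-perm _ _ eq)

  σ^-return : ∀ {i j} x → i < j → σ^ i x ≡ σ^ j x → σ^ (j ∸ i) x ≡ x
  σ^-return {i} {j} x i<j eq = sym (σ^-injective i (trans eq (begin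
    σ^ j x                ≡⟨ cong (λ k → σ^ k x) (sym (ℕₚ.m∸n+n≡m (ℕₚ.<⇒≤ i<j))) ⟩
    σ^ (j ∸ i +ℕ i) x     ≡⟨ σ^-+ (j ∸ i) i x ⟩
    σ^ (j ∸ i) (σ^ i x)   ≡⟨ σ^-comm (j ∸ i) i x ⟩
    σ^ i (σ^ (j ∸ i) x)   ∎)))
    where open ≡-Reasoning

  NoReturnBelow : Fin n → ℕ → Set
  NoReturnBelow x r = ∀ j → 1 ≤ j → j < r → σ^ j x ≢ x

  record IsCycleLength (x : Fin n) (r : ℕ) : Set where
    field
      positive  : 1 ≤ r
      returns   : σ^ r x ≡ x
      minimal   : NoReturnBelow x r

  returns-within-n : ∀ x → ∃ λ d → 1 ≤ d × d ≤ n × σ^ d x ≡ x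
  returns-within-n x with Finₚ.pigeonhole (ℕₚ.n<1+n n) (λ (k : Fin (suc n)) → σ^ (Fin.toℕ k) x)
  ... | i , j , i<j , eq =
    Fin.toℕ j ∸ Fin.toℕ i , ℕₚ.m<n⇒0<n∸m i<j ,
    ℕₚ.≤-trans (ℕₚ.m∸n≤m (Fin.toℕ j) (Fin.toℕ i)) (ℕₚ.≤-pred (Finₚ.toℕ<n j)) , σ^-return x i<j eq

  firstReturn-range : ∀ x k a → NoReturnBelow x a → (∃ λ j → a ≤ j × j < a +ℕ k × σ^ j x ≡ x) →
    let r = firstReturn σ x (range a k) in a ≤ r × r < a +ℕ k × σ^ r x ≡ x × NoReturnBelow x r
  firstReturn-range x zero a none (j , a≤j , j<a+0 , _) =
    ⊥-elim (ℕₚ.<-irrefl refl (ℕₚ.<-≤-trans j<a+0 (ℕₚ.≤-trans (ℕₚ.≤-reflexive (ℕₚ.+-identityʳ a)) a≤j)))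
  firstReturn-range x (suc k) a none (j , a≤j , j<a+k , σʲx≡x) with σ^ a x ≟ x
  ... | yes σᵃx≡x = ℕₚ.≤-refl , ℕₚ.m<m+n a (s≤s z≤n) , σᵃx≡x , none
  ... | no  σᵃx≢x with firstReturn-range x k (suc a) none′
                         (j , a<j , ℕₚ.<-≤-trans j<a+k (ℕₚ.≤-reflexive (ℕₚ.+-suc a k)) , σʲx≡x)
    where
    none′ : NoReturnBelow x (suc a)
    none′ i 1≤i i<1+a with ℕₚ.m≤n⇒m<n∨m≡n (ℕₚ.≤-pred i<1+a)
    ... | inj₁ i<a  = none i 1≤i i<a
    ... | inj₂ refl = σᵃx≢x
    a<j : suc a ≤ j
    a<j with ℕₚ.m≤n⇒m<n∨m≡n a≤j
    ... | inj₁ a<j  = a<j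
    ... | inj₂ refl = ⊥-elim (σᵃx≢x σʲx≡x)
  ... | 1+a≤r , r<1+a+k , returns , minimal =
    ℕₚ.<⇒≤ 1+a≤r , ℕₚ.<-≤-trans r<1+a+k (ℕₚ.≤-reflexive (sym (ℕₚ.+-suc a k))) , returns , minimal

  cycLen-spec : ∀ x → cycLen σ x ≤ n × IsCycleLength x (cycLen σ x)
  cycLen-spec x with returns-within-n x
  ... | d , 1≤d , d≤n , σᵈx≡x rewrite map-suc-upTo n
    with firstReturn-range x n 1 (λ j 1≤j j<1 → ⊥-elim (ℕₚ.<-irrefl refl (ℕₚ.<-≤-trans j<1 1≤j)))
                               (d , 1≤d , s≤s d≤n , σᵈx≡x)
  ... | 1≤r , r<1+n , returns , minimal = ℕₚ.≤-pred r<1+n , record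
    { positive = 1≤r ; returns = returns ; minimal = minimal }

  isCycleLength-unique : ∀ {x r s} → IsCycleLength x r → IsCycleLength x s → r ≡ s
  isCycleLength-unique {r = r} {s} r-cyc s-cyc with ℕₚ.<-cmp r s
  ... | tri< r<s _ _ = ⊥-elim (IsCycleLength.minimal s-cyc r (IsCycleLength.positive r-cyc) r<s
                                                     (IsCycleLength.returns r-cyc))
  ... | tri≈ _ r≡s _ = r≡s
  ... | tri> _ _ s<r = ⊥-elim (IsCycleLength.minimal r-cyc s (IsCycleLength.positive s-cyc) s<r
                                                     (IsCycleLength.returns s-cyc))

  module Orbit (x₀ : Fin n) where

    L : ℕ
    L = cycLen σ x₀

    L-cyc : IsCycleLength x₀ L
    L-cyc = proj₂ (cycLen-spec x₀)

    open IsCycleLength L-cyc renaming (positive to 1≤L; returns to σᴸx₀≡x₀; minimal to minimalL)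

    inOrbit : Fin n → Bool
    inOrbit y = does (any? (λ j → σ^ j x₀ ≟ y) (upTo L))

    inOrbit⁻ : ∀ {y} → inOrbit y ≡ true → ∃ λ j → j < L × σ^ j x₀ ≡ y
    inOrbit⁻ {y} y∈O with any? (λ j → σ^ j x₀ ≟ y) (upTo L)
    inOrbit⁻ {y} refl | yes any with find any
    ... | j , j∈ , σʲx₀≡y = j , ∈ₚ.∈-upTo⁻ j∈ , σʲx₀≡y

    inOrbit⁺ : ∀ {y} j → j < L → σ^ j x₀ ≡ y → inOrbit y ≡ true
    inOrbit⁺ {y} j j<L σʲx₀≡y with any? (λ j → σ^ j x₀ ≟ y) (upTo L)
    ... | yes _  = refl
    ... | no ¬any = ⊥-elim (¬any (lose (∈ₚ.∈-upTo⁺ j<L) σʲx₀≡y))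

    inOrbit-x₀ : inOrbit x₀ ≡ true
    inOrbit-x₀ = inOrbit⁺ 0 1≤L refl

    inOrbit-σ : ∀ {y} → inOrbit y ≡ true → inOrbit (app σ y) ≡ true
    inOrbit-σ y∈O with inOrbit⁻ y∈O
    ... | j , j<L , refl with ℕₚ.m≤n⇒m<n∨m≡n j<L
    ...   | inj₁ 1+j<L  = inOrbit⁺ (suc j) 1+j<L refl
    ...   | inj₂ 1+j≡L = inOrbit⁺ 0 1≤L (sym (trans (cong (λ k → σ^ k x₀) 1+j≡L) σᴸx₀≡x₀))

    inOrbit-σ⁻ : ∀ {y} → inOrbit (app σ y) ≡ true → inOrbit y ≡ true
    inOrbit-σ⁻ σy∈O with inOrbit⁻ σy∈O
    ... | suc j , j<L , σʲ⁺¹x₀≡σy =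
      inOrbit⁺ j (ℕₚ.<-trans (ℕₚ.n<1+n j) j<L) (σ-perm _ _ σʲ⁺¹x₀≡σy)
    ... | zero  , _   , x₀≡σy     = inOrbit⁺ (L ∸ 1) (ℕₚ.≤-reflexive 1+[L∸1]≡L)
      (σ-perm _ _ (trans (cong (λ k → σ^ k x₀) 1+[L∸1]≡L) (trans σᴸx₀≡x₀ x₀≡σy)))
      where 1+[L∸1]≡L = ℕₚ.m+[n∸m]≡n 1≤L

    cycLen-inOrbit : ∀ {y} → inOrbit y ≡ true → cycLen σ y ≡ L
    cycLen-inOrbit y∈O with inOrbit⁻ y∈O
    ... | j , _ , refl = isCycleLength-unique (proj₂ (cycLen-spec (σ^ j x₀))) record
      { positive = 1≤L
      ; returns  = trans (σ^-comm L j x₀) (cong (σ^ j) σᴸx₀≡x₀)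
      ; minimal  = λ i 1≤i i<L σⁱy≡y →
                     minimalL i 1≤i i<L (σ^-injective j (trans (σ^-comm j i x₀) σⁱy≡y))
      }

    count-inOrbit : count inOrbit ≡ L
    count-inOrbit = begin
      count inOrbit                                  ≡⟨ length-filter-tabulate inOrbit? (λ y → y) ⟨
      length (filter inOrbit? (allFinList n))        ≡⟨ ↭ₚ.↭-length orbit↭ ⟨
      length (map (λ j → σ^ j x₀) (upTo L))          ≡⟨ Listₚ.length-map _ (upTo L) ⟩
      length (upTo L)                                ≡⟨ Listₚ.length-upTo L ⟩
      L                                              ∎
      where
      open ≡-Reasoning
      inOrbit? = T? ∘ inOrbit
      distinct : ∀ {i j} → i < j → j < L → σ^ i x₀ ≢ σ^ j x₀
      distinct {i} {j} i<j j<L eq =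
        minimalL (j ∸ i) (ℕₚ.m<n⇒0<n∸m i<j) (ℕₚ.≤-<-trans (ℕₚ.m∸n≤m j i) j<L) (σ^-return x₀ i<j eq)
      injective : InjectiveOn (upTo L) (λ j → σ^ j x₀)
      injective {i} {j} i∈ j∈ eq with ℕₚ.<-cmp i j
      ... | tri< i<j _ _ = ⊥-elim (distinct i<j (∈ₚ.∈-upTo⁻ j∈) eq)
      ... | tri≈ _ i≡j _ = i≡j
      ... | tri> _ _ j<i = ⊥-elim (distinct j<i (∈ₚ.∈-upTo⁻ i∈) (sym eq))
      orbit↭ : map (λ j → σ^ j x₀) (upTo L) ↭ filter inOrbit? (allFinList n)
      orbit↭ = map-↭-bijectiveOn _ (Uniqueₚ.upTo⁺ L) (Uniqueₚ.filter⁺ inOrbit? (Unique-allFinList n)) injective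
        (λ {j} j∈ → ∈ₚ.∈-filter⁺ inOrbit? (allFinList-∈ _)
                      (Equivalence.from Boolₚ.T-≡ (inOrbit⁺ j (∈ₚ.∈-upTo⁻ j∈) refl)))
        (λ {y} y∈ → let j , j<L , eq = inOrbit⁻ (Equivalence.to Boolₚ.T-≡
                                         (proj₂ (∈ₚ.∈-filter⁻ inOrbit? {xs = allFinList n} y∈)))
                     in j , ∈ₚ.∈-upTo⁺ j<L , eq)

-- Colourings constant on the cycles of a permutation

-- Division with a /⁺ 0 = 0, matching the convention cyc 0 σ = 0.
_/⁺_ : ℕ → ℕ → ℕ
a /⁺ zero  = 0
a /⁺ suc i = a / suc i

0/⁺n≡0 : ∀ i → 0 /⁺ i ≡ 0
0/⁺n≡0 zero    = refl
0/⁺n≡0 (suc i) = ℕ÷.0/n≡0 (suc i)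

[n+a]/⁺n≡1+a/⁺n : ∀ {i} a → 1 ≤ i → (i +ℕ a) /⁺ i ≡ suc (a /⁺ i)
[n+a]/⁺n≡1+a/⁺n {suc k} a _ = trans (ℕ÷.m/n≡1+[m∸n]/n (ℕₚ.m≤m+n (suc k) a))
                                     (cong (λ b → suc (b / suc k)) (ℕₚ.m+n∸m≡n (suc k) a))

∧-swapʳ : ∀ a b c → (a ∧ b) ∧ c ≡ (a ∧ c) ∧ b
∧-swapʳ true  b c = Boolₚ.∧-comm b c
∧-swapʳ false b c = refl

∧-not≡true : ∀ a b → a ∧ not b ≡ true → a ≡ true × b ≡ false
∧-not≡true true false _ = refl , refl

module Colourings {n m′ : ℕ} (σ : Map n) (σ-perm : IsPerm σ) where
  open ExponentLists (suc m′)
  open Orbits σ σ-perm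

  Colouring : Set
  Colouring = Vec (Fin (suc m′)) n

  Region : Set
  Region = Fin n → Bool

  Invariant : Region → Set
  Invariant S = ∀ x → S x ≡ true → S (app σ x) ≡ true

  -- Colourings constant along σ inside S, normalised to colour 0 outside S so that they are
  -- determined by their restriction to S.
  IsCycleColouring : Region → Colouring → Set
  IsCycleColouring S f = (∀ x → S x ≡ true → lookup f (app σ x) ≡ lookup f x)
                       × (∀ x → S x ≡ false → lookup f x ≡ Fin.zero)

  isCycleColouring? : ∀ S f → Dec (IsCycleColouring S f)
  isCycleColouring? S f =
    Finₚ.all? (λ x → (S x Bool.≟ true) →-dec (lookup f (app σ x) ≟ lookup f x))
    ×-dec Finₚ.all? (λ x → (S x Bool.≟ false) →-dec (lookup f x ≟ Fin.zero))

  colourings : List Colouring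
  colourings = allVecs (allFinList (suc m′)) n

  cycleColourings : Region → List Colouring
  cycleColourings S = filter (isCycleColouring? S) colourings

  ∈-cycleColourings⁺ : ∀ {S} f → IsCycleColouring S f → f ∈ cycleColourings S
  ∈-cycleColourings⁺ {S} f = ∈ₚ.∈-filter⁺ (isCycleColouring? S) (allVecs-∈ f (allFinList-∈ ∘ lookup f))

  ∈-cycleColourings⁻ : ∀ S {f} → f ∈ cycleColourings S → IsCycleColouring S f
  ∈-cycleColourings⁻ S = proj₂ ∘ ∈ₚ.∈-filter⁻ (isCycleColouring? S) {xs = colourings}

  Unique-cycleColourings : ∀ S → Unique (cycleColourings S)
  Unique-cycleColourings S =
    Uniqueₚ.filter⁺ (isCycleColouring? S) (Unique-allVecs (Unique-allFinList (suc m′)) n)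

  content : Region → Colouring → Vec ℕ (suc m′)
  content S f = tabulate (λ i → count (λ x → S x ∧ does (lookup f x ≟ i)))

  lookup-content : ∀ S f i → lookup (content S f) i ≡ count (λ x → S x ∧ does (lookup f x ≟ i))
  lookup-content S f i = Vecₚ.lookup∘tabulate (λ i → count (λ x → S x ∧ does (lookup f x ≟ i))) i

  contentExps : Region → List (Vec ℕ (suc m′))
  contentExps S = map (content S) (cycleColourings S)

  cycleCount : Region → ℕ → ℕ
  cycleCount S i = count (λ x → S x ∧ does (cycLen σ x ℕ.≟ i)) /⁺ i

  cycleIndexExpsOn : Region → List (Vec ℕ (suc m′))
  cycleIndexExpsOn S = ⨂ (map (λ i → powerSumExps i ^⊗ cycleCount S i) (map suc (upTo n)))

  contentExps-empty : ∀ S → (∀ x → S x ≡ false) → contentExps S ↭ cycleIndexExpsOn S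
  contentExps-empty S S≡∅ = begin
    map (content S) (cycleColourings S)  ↭⟨ ↭ₚ.map⁺ (content S) (↭-sym only-blank) ⟩
    content S blank ∷ []                 ≡⟨ cong (_∷ []) (lookup-ext content≡0) ⟩
    0v ∷ []                              ≡⟨ ⨂-ones _ cycleCount≡0 (map suc (upTo n)) ⟨
    cycleIndexExpsOn S                   ∎
    where
    open ↭.PermutationReasoning
    blank : Colouring
    blank = Vec.replicate n Fin.zero
    blank-cyc : IsCycleColouring S blank
    blank-cyc = (λ x Sx → case trans (sym (S≡∅ x)) Sx of λ ()) , (λ x _ → Vecₚ.lookup-replicate x Fin.zero)
    only-blank : map (λ f → f) (blank ∷ []) ↭ cycleColourings S
    only-blank = map-↭-bijectiveOn (λ f → f) (All.[] ∷ []) (Unique-cycleColourings S)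
      (λ { (here refl) (here refl) _ → refl })
      (λ { (here refl) → ∈-cycleColourings⁺ blank blank-cyc })
      (λ f∈ → blank , here refl , lookup-ext λ x →
                trans (Vecₚ.lookup-replicate x Fin.zero) (sym (proj₂ (∈-cycleColourings⁻ S f∈) x (S≡∅ x))))
    content≡0 : ∀ i → lookup (content S blank) i ≡ lookup 0v i
    content≡0 i = trans (lookup-content S blank i)
      (trans (count-false _ (λ x → cong (_∧ _) (S≡∅ x))) (sym (Vecₚ.lookup-replicate i 0)))
    cycleCount≡0 : ∀ i → powerSumExps i ^⊗ cycleCount S i ≡ 0v ∷ []
    cycleCount≡0 i = cong (powerSumExps i ^⊗_)
      (trans (cong (_/⁺ i) (count-false _ (λ x → cong (_∧ does (cycLen σ x ℕ.≟ i)) (S≡∅ x)))) (0/⁺n≡0 i))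

  module RemoveOrbit (S : Region) (S-inv : Invariant S) (x₀ : Fin n) (Sx₀ : S x₀ ≡ true) where
    open Orbit x₀

    σ^x₀∈S : ∀ j → S (σ^ j x₀) ≡ true
    σ^x₀∈S zero    = Sx₀
    σ^x₀∈S (suc j) = S-inv _ (σ^x₀∈S j)

    orbit⊆S : ∀ {y} → inOrbit y ≡ true → S y ≡ true
    orbit⊆S y∈O with inOrbit⁻ y∈O
    ... | j , _ , refl = σ^x₀∈S j

    S′ : Region
    S′ y = S y ∧ not (inOrbit y)

    -- Unlike with-abstraction on inOrbit y, this case split does not rewrite the unfolded S′ y
    -- in the types of other hypotheses.
    orbit-cases : ∀ {P : Set} y → (inOrbit y ≡ true → P) → (inOrbit y ≡ false → P) → P
    orbit-cases {P} y on off = go (inOrbit y) refl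
      where
      go : ∀ b → inOrbit y ≡ b → P
      go true  = on
      go false = off

    S′-orbit : ∀ {y} → inOrbit y ≡ true → S′ y ≡ false
    S′-orbit {y} y∈O rewrite y∈O = Boolₚ.∧-zeroʳ (S y)

    S′-off : ∀ {y} → inOrbit y ≡ false → S′ y ≡ S y
    S′-off {y} y∉O rewrite y∉O = Boolₚ.∧-identityʳ (S y)

    S′⇒off : ∀ {y} → S′ y ≡ true → inOrbit y ≡ false
    S′⇒off {y} = proj₂ ∘ ∧-not≡true (S y) (inOrbit y)

    S′⇒S : ∀ {y} → S′ y ≡ true → S y ≡ true
    S′⇒S {y} = proj₁ ∘ ∧-not≡true (S y) (inOrbit y)

    S′-invariant : Invariant S′
    S′-invariant y S′y = orbit-cases (app σ y)
      (λ σy∈O → case trans (sym (S′⇒off S′y)) (inOrbit-σ⁻ σy∈O) of λ ())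
      (λ σy∉O → trans (S′-off σy∉O) (S-inv y (S′⇒S S′y)))

    S′-∧-cong : ∀ {p q : Fin n → Bool} → (∀ {y} → inOrbit y ≡ false → p y ≡ q y) →
                ∀ y → S′ y ∧ p y ≡ S′ y ∧ q y
    S′-∧-cong {p} {q} p≡q y = orbit-cases y
      (λ y∈O → trans (cong (_∧ p y) (S′-orbit y∈O)) (sym (cong (_∧ q y) (S′-orbit y∈O))))
      (λ y∉O → cong (S′ y ∧_) (p≡q y∉O))

    count-S′<count-S : count S′ < count S
    count-S′<count-S = ℕₚ.≤-trans
      (ℕₚ.+-monoˡ-≤ (count S′) (count-pos (λ y → S y ∧ inOrbit y) x₀ (cong₂ _∧_ Sx₀ inOrbit-x₀)))
      (ℕₚ.≤-reflexive (sym (count-split S inOrbit)))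

    count-orbit-∧ : ∀ b → count (λ y → inOrbit y ∧ b) ≡ L *ℕ 𝟙 b
    count-orbit-∧ true  =
      trans (count-cong (Boolₚ.∧-identityʳ ∘ inOrbit)) (trans count-inOrbit (sym (ℕₚ.*-identityʳ L)))
    count-orbit-∧ false = trans (count-false _ (Boolₚ.∧-zeroʳ ∘ inOrbit)) (sym (ℕₚ.*-zeroʳ L))

    count-removeOrbit : ∀ (q : Fin n → Bool) b → (∀ {y} → inOrbit y ≡ true → q y ≡ b) →
                        count (λ y → S y ∧ q y) ≡ L *ℕ 𝟙 b +ℕ count (λ y → S′ y ∧ q y)
    count-removeOrbit q b q≡b = trans (count-split (λ y → S y ∧ q y) inOrbit)
      (cong₂ _+ℕ_ (trans (count-cong on-orbit) (count-orbit-∧ b))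
                  (count-cong (λ y → ∧-swapʳ (S y) (q y) (not (inOrbit y)))))
      where
      on-orbit : ∀ y → (S y ∧ q y) ∧ inOrbit y ≡ inOrbit y ∧ b
      on-orbit y with inOrbit y in y∈O
      ... | true rewrite orbit⊆S y∈O | q≡b y∈O = Boolₚ.∧-identityʳ b
      ... | false = Boolₚ.∧-zeroʳ _

    paint : Fin (suc m′) × Colouring → Colouring
    paint (c , g) = tabulate (λ y → if inOrbit y then c else lookup g y)

    lookup-paint-orbit : ∀ c g {y} → inOrbit y ≡ true → lookup (paint (c , g)) y ≡ c
    lookup-paint-orbit c g {y} y∈O =
      trans (Vecₚ.lookup∘tabulate _ y) (cong (if_then c else lookup g y) y∈O)

    lookup-paint-off : ∀ c g {y} → inOrbit y ≡ false → lookup (paint (c , g)) y ≡ lookup g y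
    lookup-paint-off c g {y} y∉O =
      trans (Vecₚ.lookup∘tabulate _ y) (cong (if_then c else lookup g y) y∉O)

    content-paint : ∀ c g → content S (paint (c , g)) ≡ powerExp c L +v content S′ g
    content-paint c g = lookup-ext λ i → begin
      lookup (content S (paint (c , g))) i
        ≡⟨ lookup-content S (paint (c , g)) i ⟩
      count (λ y → S y ∧ does (lookup (paint (c , g)) y ≟ i))
        ≡⟨ count-removeOrbit _ (does (c ≟ i)) (λ y∈O → cong (λ d → does (d ≟ i)) (lookup-paint-orbit c g y∈O)) ⟩
      L *ℕ 𝟙 (does (c ≟ i)) +ℕ count (λ y → S′ y ∧ does (lookup (paint (c , g)) y ≟ i))
        ≡⟨ cong (L *ℕ 𝟙 (does (c ≟ i)) +ℕ_)
                (count-cong (S′-∧-cong λ y∉O → cong (λ d → does (d ≟ i)) (lookup-paint-off c g y∉O))) ⟩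
      L *ℕ 𝟙 (does (c ≟ i)) +ℕ count (λ y → S′ y ∧ does (lookup g y ≟ i))
        ≡⟨ cong₂ _+ℕ_ (lookup-powerExp c L i) (lookup-content S′ g i) ⟨
      lookup (powerExp c L) i +ℕ lookup (content S′ g) i
        ≡⟨ Vecₚ.lookup-zipWith _+ℕ_ i (powerExp c L) (content S′ g) ⟨
      lookup (powerExp c L +v content S′ g) i ∎
      where open ≡-Reasoning

    coloursAndColourings′ : List (Fin (suc m′) × Colouring)
    coloursAndColourings′ = dependentPairs (allFinList (suc m′)) (λ _ → cycleColourings S′)

    paint-cycleColouring : ∀ c g → IsCycleColouring S′ g → IsCycleColouring S (paint (c , g))
    paint-cycleColouring c g (g-const , g-zero) = const , zero-outside
      where
      const : ∀ x → S x ≡ true → lookup (paint (c , g)) (app σ x) ≡ lookup (paint (c , g)) x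
      const x Sx with inOrbit x in x∈O
      ... | true  = trans (lookup-paint-orbit c g (inOrbit-σ x∈O)) (sym (lookup-paint-orbit c g x∈O))
      ... | false = trans (lookup-paint-off c g (S′⇒off (S′-invariant x S′x)))
                          (trans (g-const x S′x) (sym (lookup-paint-off c g x∈O)))
        where S′x = trans (S′-off x∈O) Sx
      zero-outside : ∀ x → S x ≡ false → lookup (paint (c , g)) x ≡ Fin.zero
      zero-outside x Sx≡false with inOrbit x in x∈O
      ... | true  = case trans (sym Sx≡false) (orbit⊆S x∈O) of λ ()
      ... | false = trans (lookup-paint-off c g x∈O) (g-zero x (trans (S′-off x∈O) Sx≡false))

    constant-on-orbit : ∀ f → IsCycleColouring S f → ∀ {y} → inOrbit y ≡ true → lookup f y ≡ lookup f x₀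
    constant-on-orbit f (f-const , _) y∈O with inOrbit⁻ y∈O
    ... | j , _ , refl = along j
      where
      along : ∀ j → lookup f (σ^ j x₀) ≡ lookup f x₀
      along zero    = refl
      along (suc j) = trans (f-const (σ^ j x₀) (σ^x₀∈S j)) (along j)

    erase : Colouring → Colouring
    erase f = paint (Fin.zero , f)

    erase-cycleColouring : ∀ f → IsCycleColouring S f → IsCycleColouring S′ (erase f)
    erase-cycleColouring f (f-const , f-zero) = const , zero-outside
      where
      const : ∀ x → S′ x ≡ true → lookup (erase f) (app σ x) ≡ lookup (erase f) x
      const x S′x = trans (lookup-paint-off _ f (S′⇒off (S′-invariant x S′x)))
                          (trans (f-const x (S′⇒S S′x)) (sym (lookup-paint-off _ f (S′⇒off S′x))))
      zero-outside : ∀ x → S′ x ≡ false → lookup (erase f) x ≡ Fin.zero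
      zero-outside x S′x≡false = orbit-cases x
        (lookup-paint-orbit _ f)
        (λ x∉O → trans (lookup-paint-off _ f x∉O) (f-zero x (trans (sym (S′-off x∉O)) S′x≡false)))

    paint-↭ : map paint coloursAndColourings′ ↭ cycleColourings S
    paint-↭ = map-↭-bijectiveOn paint
      (Unique-concatMap-map⁺ _,_ _ ,-injective (Unique-allFinList (suc m′)) (λ _ → Unique-cycleColourings S′))
      (Unique-cycleColourings S) injective into onto
      where
      into : ∀ {p} → p ∈ coloursAndColourings′ → paint p ∈ cycleColourings S
      into p∈ with ∈-concatMap-map⁻ _,_ (λ _ → cycleColourings S′) (allFinList (suc m′)) p∈
      ... | c , g , _ , g∈ , refl =
        ∈-cycleColourings⁺ (paint (c , g)) (paint-cycleColouring c g (∈-cycleColourings⁻ S′ g∈))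
      onto : ∀ {f} → f ∈ cycleColourings S → ∃ λ p → p ∈ coloursAndColourings′ × paint p ≡ f
      onto {f} f∈ = (lookup f x₀ , erase f)
        , ∈-concatMap-map⁺ _,_ _ (allFinList-∈ (lookup f x₀))
                                 (∈-cycleColourings⁺ (erase f) (erase-cycleColouring f f-cyc))
        , lookup-ext repaint
        where
        f-cyc = ∈-cycleColourings⁻ S f∈
        repaint : ∀ y → lookup (paint (lookup f x₀ , erase f)) y ≡ lookup f y
        repaint y with inOrbit y in y∈O
        ... | true  = trans (lookup-paint-orbit (lookup f x₀) (erase f) y∈O) (sym (constant-on-orbit f f-cyc y∈O))
        ... | false = trans (lookup-paint-off (lookup f x₀) (erase f) y∈O) (lookup-paint-off Fin.zero f y∈O)
      injective : InjectiveOn coloursAndColourings′ paint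
      injective p∈ q∈ eq
        with ∈-concatMap-map⁻ _,_ (λ _ → cycleColourings S′) (allFinList (suc m′)) p∈
           | ∈-concatMap-map⁻ _,_ (λ _ → cycleColourings S′) (allFinList (suc m′)) q∈
      ... | c , g , _ , g∈ , refl | c′ , g′ , _ , g′∈ , refl = cong₂ _,_ c≡c′ (lookup-ext g≗g′)
        where
        paint≗ : ∀ y → lookup (paint (c , g)) y ≡ lookup (paint (c′ , g′)) y
        paint≗ y = cong (λ v → lookup v y) eq
        c≡c′ : c ≡ c′
        c≡c′ = trans (sym (lookup-paint-orbit c g inOrbit-x₀))
                     (trans (paint≗ x₀) (lookup-paint-orbit c′ g′ inOrbit-x₀))
        g≗g′ : ∀ y → lookup g y ≡ lookup g′ y
        g≗g′ y with inOrbit y in y∈O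
        ... | true  = trans (proj₂ (∈-cycleColourings⁻ S′ g∈) y (S′-orbit y∈O))
                            (sym (proj₂ (∈-cycleColourings⁻ S′ g′∈) y (S′-orbit y∈O)))
        ... | false = trans (sym (lookup-paint-off c g y∈O)) (trans (paint≗ y) (lookup-paint-off c′ g′ y∈O))

    contentExps-removeOrbit : contentExps S ↭ powerSumExps L ⊗ contentExps S′
    contentExps-removeOrbit = begin
      map (content S) (cycleColourings S)
        ↭⟨ ↭ₚ.map⁺ (content S) (↭-sym paint-↭) ⟩
      map (content S) (map paint coloursAndColourings′)
        ≡⟨ Listₚ.map-∘ coloursAndColourings′ ⟨
      map (content S ∘ paint) coloursAndColourings′
        ≡⟨ Listₚ.map-cong (λ (c , g) → content-paint c g) coloursAndColourings′ ⟩
      map shiftedContent coloursAndColourings′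
        ≡⟨ Listₚ.map-concatMap shiftedContent (λ c → map (c ,_) (cycleColourings S′)) colours ⟩
      concatMap (λ c → map shiftedContent (map (c ,_) (cycleColourings S′))) colours
        ≡⟨ Listₚ.concatMap-cong (λ c → trans (sym (Listₚ.map-∘ (cycleColourings S′)))
                                             (Listₚ.map-∘ (cycleColourings S′))) colours ⟩
      concatMap (λ c → map (powerExp c L +v_) (contentExps S′)) colours
        ≡⟨ Listₚ.concatMap-map (λ a → map (a +v_) (contentExps S′)) (λ c → powerExp c L) colours ⟨
      powerSumExps L ⊗ contentExps S′ ∎
      where
      open ↭.PermutationReasoning
      colours = allFinList (suc m′)
      shiftedContent : Fin (suc m′) × Colouring → Vec ℕ (suc m′)
      shiftedContent (c , g) = powerExp c L +v content S′ g

    cycleLengthCount-removeOrbit : ∀ i →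
      count (λ x → S x ∧ does (cycLen σ x ℕ.≟ i)) ≡ L *ℕ 𝟙 (does (L ℕ.≟ i)) +ℕ count (λ x → S′ x ∧ does (cycLen σ x ℕ.≟ i))
    cycleLengthCount-removeOrbit i =
      count-removeOrbit _ (does (L ℕ.≟ i)) (λ y∈O → cong (λ l → does (l ℕ.≟ i)) (cycLen-inOrbit y∈O))

    cycleCount-removeOrbit-≢ : ∀ i → i ≢ L → cycleCount S i ≡ cycleCount S′ i
    cycleCount-removeOrbit-≢ i i≢L = cong (_/⁺ i) (begin
      count (λ x → S x ∧ does (cycLen σ x ℕ.≟ i))  ≡⟨ cycleLengthCount-removeOrbit i ⟩
      L *ℕ 𝟙 (does (L ℕ.≟ i)) +ℕ rest             ≡⟨ cong (λ b → L *ℕ 𝟙 b +ℕ rest) L≟i≡false ⟩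
      L *ℕ 0 +ℕ rest                               ≡⟨ cong (_+ℕ rest) (ℕₚ.*-zeroʳ L) ⟩
      rest                                         ∎)
      where
      open ≡-Reasoning
      rest = count (λ x → S′ x ∧ does (cycLen σ x ℕ.≟ i))
      L≟i≡false = dec-false (L ℕ.≟ i) (i≢L ∘ sym)

    cycleCount-removeOrbit-L : cycleCount S L ≡ suc (cycleCount S′ L)
    cycleCount-removeOrbit-L = begin
      count (λ x → S x ∧ does (cycLen σ x ℕ.≟ L)) /⁺ L  ≡⟨ cong (_/⁺ L) (cycleLengthCount-removeOrbit L) ⟩
      (L *ℕ 𝟙 (does (L ℕ.≟ L)) +ℕ rest) /⁺ L           ≡⟨ cong (λ b → (L *ℕ 𝟙 b +ℕ rest) /⁺ L) L≟L≡true ⟩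
      (L *ℕ 1 +ℕ rest) /⁺ L                             ≡⟨ cong (λ l → (l +ℕ rest) /⁺ L) (ℕₚ.*-identityʳ L) ⟩
      (L +ℕ rest) /⁺ L                                  ≡⟨ [n+a]/⁺n≡1+a/⁺n rest 1≤L ⟩
      suc (rest /⁺ L)                                   ∎
      where
      open ≡-Reasoning
      open IsCycleLength L-cyc renaming (positive to 1≤L)
      rest = count (λ x → S′ x ∧ does (cycLen σ x ℕ.≟ L))
      L≟L≡true = dec-true (L ℕ.≟ L) refl

    cycleIndexExpsOn-removeOrbit : cycleIndexExpsOn S ↭ powerSumExps L ⊗ cycleIndexExpsOn S′
    cycleIndexExpsOn-removeOrbit = ⨂-update (map suc (upTo n))
      (λ i → powerSumExps i ^⊗ cycleCount S′ i) (λ i → powerSumExps i ^⊗ cycleCount S i) (powerSumExps L) L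
      (Uniqueₚ.map⁺ ℕₚ.suc-injective (Uniqueₚ.upTo⁺ n)) L∈
      (λ i i≢L → cong (powerSumExps i ^⊗_) (cycleCount-removeOrbit-≢ i i≢L))
      (cong (powerSumExps L ^⊗_) cycleCount-removeOrbit-L)
      where
      open IsCycleLength L-cyc renaming (positive to 1≤L)
      1+[L∸1]≡L : suc (L ∸ 1) ≡ L
      1+[L∸1]≡L = ℕₚ.m+[n∸m]≡n 1≤L
      L∈ : L ∈ map suc (upTo n)
      L∈ = subst (_∈ map suc (upTo n)) 1+[L∸1]≡L
        (∈ₚ.∈-map⁺ suc (∈ₚ.∈-upTo⁺ (ℕₚ.≤-trans (ℕₚ.≤-reflexive 1+[L∸1]≡L) (proj₁ (cycLen-spec x₀)))))

  -- Induction on the size of S (bounded by k), removing the orbit of some point of S at each step.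
  contentExps↭cycleIndexExpsOn : ∀ k S → count S ≤ k → Invariant S → contentExps S ↭ cycleIndexExpsOn S
  contentExps↭cycleIndexExpsOn k S #S≤k S-inv with count S ℕ.≟ 0
  ... | yes #S≡0 = contentExps-empty S (count≡0⇒false S #S≡0)
  contentExps↭cycleIndexExpsOn zero    S #S≤0 S-inv | no #S≢0 = ⊥-elim (#S≢0 (ℕₚ.n≤0⇒n≡0 #S≤0))
  contentExps↭cycleIndexExpsOn (suc k) S #S≤k S-inv | no #S≢0
    with count-witness S (ℕₚ.n≢0⇒n>0 #S≢0)
  ... | x₀ , Sx₀ = begin
    contentExps S                          ↭⟨ contentExps-removeOrbit ⟩
    powerSumExps L ⊗ contentExps S′       ↭⟨ ⊗-congʳ (powerSumExps L) IH ⟩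
    powerSumExps L ⊗ cycleIndexExpsOn S′  ↭⟨ cycleIndexExpsOn-removeOrbit ⟨
    cycleIndexExpsOn S                     ∎
    where
    open ↭.PermutationReasoning
    open RemoveOrbit S S-inv x₀ Sx₀
    L = Orbit.L x₀
    IH = contentExps↭cycleIndexExpsOn k S′ (ℕₚ.≤-pred (ℕₚ.≤-trans count-S′<count-S #S≤k)) S′-invariant

  everywhere : Region
  everywhere _ = true

  contentExps↭cycleIndexExps : contentExps everywhere ↭ cycleIndexExps σ
  contentExps↭cycleIndexExps = begin
    contentExps everywhere       ↭⟨ contentExps↭cycleIndexExpsOn n everywhere (count≤ everywhere) (λ _ _ → refl) ⟩
    cycleIndexExpsOn everywhere  ≡⟨ cong ⨂ (Listₚ.map-cong (λ i → cong (powerSumExps i ^⊗_) (cycleCount-everywhere i))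
                                                            (map suc (upTo n))) ⟩
    cycleIndexExps σ             ∎
    where
    open ↭.PermutationReasoning
    cycleCount-everywhere : ∀ i → cycleCount everywhere i ≡ cyc i σ
    cycleCount-everywhere zero    = refl
    cycleCount-everywhere (suc i) =
      cong (_/ suc i) (sym (length-filter-tabulate (λ x → cycLen σ x ℕ.≟ suc i) (λ x → x)))

-- Colour classes and block tuples

does≡true⇒ : ∀ {A : Set} (a? : Dec A) → does a? ≡ true → A
does≡true⇒ (yes a) _ = a

count-≟ : ∀ {m} (c : Fin m) → count (λ i → does (c ≟ i)) ≡ 1
count-≟ c = ℕₚ.≤-antisym
  (count≤1 _ λ i j c≡i c≡j → trans (sym (does≡true⇒ (c ≟ i) c≡i)) (does≡true⇒ (c ≟ j) c≡j))
  (count-pos _ c (dec-true (c ≟ c) refl))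

sum-const-1 : ∀ k → sum {k} (λ _ → 1) ≡ k
sum-const-1 zero    = refl
sum-const-1 (suc k) = cong suc (sum-const-1 k)

sumV≡sum : ∀ {k} (v : Vec ℕ k) → sumV v ≡ sum (lookup v)
sumV≡sum []      = refl
sumV≡sum (a ∷ v) = cong (a +ℕ_) (sumV≡sum v)

allSubsets-∈ : ∀ {k} (s : Subset k) → s ∈ allSubsets k
allSubsets-∈ s = allVecs-∈ s λ i → bool-∈ (lookup s i)
  where
  bool-∈ : ∀ b → b ∈ true ∷ false ∷ []
  bool-∈ true  = here refl
  bool-∈ false = there (here refl)

Unique-allSubsets : ∀ k → Unique (allSubsets k)
Unique-allSubsets = Unique-allVecs (((λ ()) All.∷ All.[]) ∷ (All.[] ∷ []))

module ColourClasses {n m′ : ℕ} (σ : Map n) (σ-perm : IsPerm σ) where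
  open Colourings {n} {m′} σ σ-perm
  open ExponentLists (suc m′)

  m : ℕ
  m = suc m′

  colourClasses : Colouring → Vec (Subset n) m
  colourClasses f = tabulate (λ i → tabulate (λ x → does (lookup f x ≟ i)))

  lookup-colourClasses : ∀ f i x → lookup (lookup (colourClasses f) i) x ≡ does (lookup f x ≟ i)
  lookup-colourClasses f i x =
    trans (cong (λ s → lookup s x) (Vecₚ.lookup∘tabulate (λ i → tabulate (λ x → does (lookup f x ≟ i))) i))
          (Vecₚ.lookup∘tabulate (λ x → does (lookup f x ≟ i)) x)

  symmetricBlockTuples : List (Vec ℕ m × Vec (Subset n) m)
  symmetricBlockTuples = dependentPairs (compositions m n) (λ k → filter (inSymα? σ) (blockTuples n k))

  shapeAndClasses : Colouring → Vec ℕ m × Vec (Subset n) m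
  shapeAndClasses f = content everywhere f , colourClasses f

  sumV-content : ∀ f → sumV (content everywhere f) ≡ n
  sumV-content f = begin
    sumV (content everywhere f)                  ≡⟨ sumV≡sum (content everywhere f) ⟩
    sum (lookup (content everywhere f))          ≡⟨ sum-cong-≋ (lookup-content everywhere f) ⟩
    sum (λ i → count (λ x → does (lookup f x ≟ i)))  ≡⟨ ∑-comm (λ i x → 𝟙 (does (lookup f x ≟ i))) ⟩
    sum (λ x → count (λ i → does (lookup f x ≟ i)))  ≡⟨ sum-cong-≋ (λ x → count-≟ (lookup f x)) ⟩
    sum {n} (λ _ → 1)                            ≡⟨ sum-const-1 n ⟩
    n                                            ∎
    where open ≡-Reasoning

  ∈-compositions⁺ : ∀ {k} → (∀ i → lookup k i ≤ n) → sumV k ≡ n → k ∈ compositions m n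
  ∈-compositions⁺ {k} k≤n =
    ∈ₚ.∈-filter⁺ (λ k → sumV k ℕ.≟ n) (allVecs-∈ k (λ i → ∈ₚ.∈-upTo⁺ (s≤s (k≤n i))))

  ∈-symmetricBlockTuples⁺ : ∀ {k α} → k ∈ compositions m n → IsBlockTuple k α → InSymα σ α →
                            (k , α) ∈ symmetricBlockTuples
  ∈-symmetricBlockTuples⁺ {k} {α} k∈ α-block σ∈Symα = ∈-concatMap-map⁺ _,_ _ k∈
    (∈ₚ.∈-filter⁺ (inSymα? σ) (∈ₚ.∈-filter⁺ (isBlockTuple? k) (allVecs-∈ α (allSubsets-∈ ∘ lookup α)) α-block)
                  σ∈Symα)

  ∈-symmetricBlockTuples⁻ : ∀ {k α} → (k , α) ∈ symmetricBlockTuples →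
                            sumV k ≡ n × IsBlockTuple k α × InSymα σ α
  ∈-symmetricBlockTuples⁻ {k} {α} kα∈
    with ∈-concatMap-map⁻ _,_ (λ k → filter (inSymα? σ) (blockTuples n k)) (compositions m n) kα∈
  ... | k , α , k∈ , α∈ , refl with ∈ₚ.∈-filter⁻ (inSymα? σ) {xs = blockTuples n k} α∈
  ...   | α∈′ , σ∈Symα =
    proj₂ (∈ₚ.∈-filter⁻ (λ k → sumV k ℕ.≟ n) {xs = allVecs (upTo (suc n)) m} k∈) ,
    proj₂ (∈ₚ.∈-filter⁻ (isBlockTuple? k) {xs = allVecs (allSubsets n) m} α∈′) ,
    σ∈Symα

  shapeAndClasses-∈ : ∀ {f} → f ∈ cycleColourings everywhere → shapeAndClasses f ∈ symmetricBlockTuples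
  shapeAndClasses-∈ {f} f∈ = ∈-symmetricBlockTuples⁺
    (∈-compositions⁺ (λ i → ℕₚ.≤-trans (ℕₚ.≤-reflexive (lookup-content everywhere f i)) (count≤ _))
                     (sumV-content f))
    (disjoint , sizes) σ-preserves
    where
    class : Fin m → Subset n
    class = lookup (colourClasses f)
    in-class⇒ : ∀ {i x} → x Sub.∈ class i → lookup f x ≡ i
    in-class⇒ {i} {x} x∈ =
      does≡true⇒ (lookup f x ≟ i) (trans (sym (lookup-colourClasses f i x)) (Vecₚ.[]=⇒lookup x∈))
    disjoint : ∀ i j → i ≢ j → Disjoint2 (class i) (class j)
    disjoint i j i≢j x x∈i x∈j = i≢j (trans (sym (in-class⇒ x∈i)) (in-class⇒ x∈j))
    sizes : ∀ i → Sub.∣ class i ∣ ≡ lookup (content everywhere f) i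
    sizes i = trans (∣∣≡count (class i))
                    (trans (count-cong (lookup-colourClasses f i)) (sym (lookup-content everywhere f i)))
    σ-preserves : InSymα σ (colourClasses f)
    σ-preserves i x x∈ = Vecₚ.lookup⇒[]= (app σ x) _ (begin
      lookup (class i) (app σ x)     ≡⟨ lookup-colourClasses f i (app σ x) ⟩
      does (lookup f (app σ x) ≟ i)  ≡⟨ cong (λ c → does (c ≟ i)) (proj₁ (∈-cycleColourings⁻ everywhere f∈) x refl) ⟩
      does (lookup f x ≟ i)          ≡⟨ lookup-colourClasses f i x ⟨
      lookup (class i) x             ≡⟨ Vecₚ.[]=⇒lookup x∈ ⟩
      true                           ∎)
      where open ≡-Reasoning

  shapeAndClasses-injective : ∀ {f g} → shapeAndClasses f ≡ shapeAndClasses g → f ≡ g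
  shapeAndClasses-injective {f} {g} eq = lookup-ext λ x → sym (does≡true⇒ (lookup g x ≟ lookup f x) (begin
    does (lookup g x ≟ lookup f x)                    ≡⟨ lookup-colourClasses g (lookup f x) x ⟨
    lookup (lookup (colourClasses g) (lookup f x)) x  ≡⟨ cong (λ cs → lookup (lookup cs (lookup f x)) x) classes≡ ⟨
    lookup (lookup (colourClasses f) (lookup f x)) x  ≡⟨ lookup-colourClasses f (lookup f x) x ⟩
    does (lookup f x ≟ lookup f x)                    ≡⟨ dec-true (lookup f x ≟ lookup f x) refl ⟩
    true                                              ∎))
    where
    open ≡-Reasoning
    classes≡ = proj₂ (,-injective eq)

  module ColouringOf {k α} (kα∈ : (k , α) ∈ symmetricBlockTuples) where

    inBlock : Fin m → Fin n → Bool
    inBlock i x = lookup (lookup α i) x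

    Σk≡n : sumV k ≡ n
    Σk≡n = proj₁ (∈-symmetricBlockTuples⁻ kα∈)

    α-block : IsBlockTuple k α
    α-block = proj₁ (proj₂ (∈-symmetricBlockTuples⁻ kα∈))

    σ∈Symα : InSymα σ α
    σ∈Symα = proj₂ (proj₂ (∈-symmetricBlockTuples⁻ kα∈))

    block-unique : ∀ {i j x} → inBlock i x ≡ true → inBlock j x ≡ true → i ≡ j
    block-unique {i} {j} {x} x∈i x∈j with i ≟ j
    ... | yes i≡j = i≡j
    ... | no  i≢j = ⊥-elim (proj₁ α-block i j i≢j x (Vecₚ.lookup⇒[]= x _ x∈i) (Vecₚ.lookup⇒[]= x _ x∈j))

    -- The blocks are disjoint and their sizes add up to n, so they cover every point exactly once.
    covered-once : ∀ x → count (λ i → inBlock i x) ≡ 1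
    covered-once = sum≡n⇒all≡1 _ (λ x → count≤1 _ (λ i j → block-unique)) (begin
      sum (λ x → count (λ i → inBlock i x))  ≡⟨ ∑-comm (λ x i → 𝟙 (inBlock i x)) ⟩
      sum (λ i → count (inBlock i))          ≡⟨ sum-cong-≋ (λ i → trans (sym (∣∣≡count (lookup α i))) (proj₂ α-block i)) ⟩
      sum (lookup k)                         ≡⟨ sumV≡sum k ⟨
      sumV k                                 ≡⟨ Σk≡n ⟩
      n                                      ∎)
      where open ≡-Reasoning

    -- Kept opaque: unfolding the witness during type checking is prohibitively expensive.
    opaque
      colourOf : Fin n → Fin m
      colourOf x = proj₁ (count-witness (λ i → inBlock i x) (ℕₚ.≤-reflexive (sym (covered-once x))))

      colourOf-inBlock : ∀ x → inBlock (colourOf x) x ≡ true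
      colourOf-inBlock x = proj₂ (count-witness (λ i → inBlock i x) (ℕₚ.≤-reflexive (sym (covered-once x))))

    colour : Colouring
    colour = tabulate colourOf

    colour-inBlock : ∀ x → inBlock (lookup colour x) x ≡ true
    colour-inBlock x =
      subst (λ i → inBlock i x ≡ true) (sym (Vecₚ.lookup∘tabulate colourOf x)) (colourOf-inBlock x)

    does-colour : ∀ i x → does (lookup colour x ≟ i) ≡ inBlock i x
    does-colour i x with lookup colour x ≟ i
    ... | yes refl = sym (colour-inBlock x)
    ... | no  c≢i with inBlock i x in x∈i
    ...   | true  = ⊥-elim (c≢i (block-unique (colour-inBlock x) x∈i))
    ...   | false = refl

    colour-∈ : colour ∈ cycleColourings everywhere
    colour-∈ = ∈-cycleColourings⁺ colour (σ-const , λ x ())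
      where
      σ-const : ∀ x → true ≡ true → lookup colour (app σ x) ≡ lookup colour x
      σ-const x _ = block-unique (colour-inBlock (app σ x))
        (Vecₚ.[]=⇒lookup (σ∈Symα (lookup colour x) x (Vecₚ.lookup⇒[]= x _ (colour-inBlock x))))

    shapeAndClasses-colour : shapeAndClasses colour ≡ (k , α)
    shapeAndClasses-colour = cong₂ _,_
      (lookup-ext λ i → trans (lookup-content everywhere colour i)
        (trans (count-cong (does-colour i)) (trans (sym (∣∣≡count (lookup α i))) (proj₂ α-block i))))
      (lookup-ext λ i → lookup-ext λ x → trans (lookup-colourClasses colour i x) (does-colour i x))

  shapeAndClasses-↭ : map shapeAndClasses (cycleColourings everywhere) ↭ symmetricBlockTuples
  shapeAndClasses-↭ = map-↭-bijectiveOn shapeAndClasses (Unique-cycleColourings everywhere)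
    (Unique-concatMap-map⁺ _,_ _ ,-injective
      (Uniqueₚ.filter⁺ (λ k → sumV k ℕ.≟ n) (Unique-allVecs (Uniqueₚ.upTo⁺ (suc n)) m))
      (λ k → Uniqueₚ.filter⁺ (inSymα? σ) (Uniqueₚ.filter⁺ (isBlockTuple? k) (Unique-allVecs (Unique-allSubsets n) m))))
    (λ _ _ → shapeAndClasses-injective) shapeAndClasses-∈
    (λ kα∈ → let open ColouringOf kα∈ in colour , colour-∈ , shapeAndClasses-colour)

  shapes↭cycleIndexExps : map proj₁ symmetricBlockTuples ↭ cycleIndexExps σ
  shapes↭cycleIndexExps = begin
    map proj₁ symmetricBlockTuples                                ↭⟨ ↭ₚ.map⁺ proj₁ (↭-sym shapeAndClasses-↭) ⟩
    map proj₁ (map shapeAndClasses (cycleColourings everywhere))  ≡⟨ Listₚ.map-∘ (cycleColourings everywhere) ⟨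
    contentExps everywhere                                        ↭⟨ contentExps↭cycleIndexExps ⟩
    cycleIndexExps σ                                              ∎
    where open ↭.PermutationReasoning

-- Exchanging the order of summation

module Expansion {c ℓ} (F : CommutativeRing c ℓ) (m′ : ℕ) where
  open CommutativeRing F
    renaming (refl to ≈-refl; sym to ≈-sym; trans to ≈-trans; reflexive to ≈-reflexive)
  open PolyRing F (suc m′)
  open Polynomials F (suc m′)
  open import Relation.Binary.Reasoning.Setoid setoid

  symmetricBlockTupleSum : ∀ {n} (σ : Map n) → IsPerm σ → ∀ e →
    Σ[ (λ k → Σ[ (λ α → when (inSymα? σ α) (λ _ → 1#) * mono k e) ] (blockTuples n k)) ] (compositions (suc m′) n)
      ≈ Z σ powerSum e
  symmetricBlockTupleSum {n} σ σ-perm e = begin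
    Σ[ (λ k → Σ[ (λ α → when (inSymα? σ α) (λ _ → 1#) * mono k e) ] (blockTuples n k)) ] ks
      ≈⟨ Σ-cong (λ k → Σ-filter (inSymα? σ) (λ _ → mono k e) (blockTuples n k)) ks ⟩
    Σ[ (λ k → Σ[ (λ _ → mono k e) ] (symmetric k)) ] ks
      ≈⟨ Σ-dependentPairs (λ (k , _) → mono k e) ks symmetric ⟨
    Σ[ (λ (k , _) → mono k e) ] symmetricBlockTuples
      ≡⟨ Σ-map (λ k → mono k e) proj₁ symmetricBlockTuples ⟨
    ⟦ map proj₁ symmetricBlockTuples ⟧ e
      ≈⟨ ⟦⟧-↭ shapes↭cycleIndexExps e ⟩
    ⟦ cycleIndexExps σ ⟧ e
      ≈⟨ Z-powerSum≈⟦⟧ σ e ⟨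
    Z σ powerSum e ∎
    where
    open ColourClasses {n} {m′} σ σ-perm
    open ExponentLists (suc m′)
    ks : List (Vec ℕ (suc m′))
    ks = compositions (suc m′) n
    symmetric : Vec ℕ (suc m′) → List (Vec (Subset n) (suc m′))
    symmetric k = filter (inSymα? σ) (blockTuples n k)

  module _ {n : ℕ} (G : Subgroup n) (Δ : (σ : Map n) → Subgroup.mem G σ → Carrier) where
    open Subgroup G

    private
      ks : List (Vec ℕ (suc m′))
      ks = compositions (suc m′) n
      αs : Vec ℕ (suc m′) → List (Vec (Subset n) (suc m′))
      αs = blockTuples n

    weight : Map n → Carrier
    weight σ = when (mem? σ) (Δ σ)

    term : Map n → Vec (Subset n) (suc m′) → Carrier
    term σ α = when (mem? σ) (λ g → when (inSymα? σ α) (λ _ → Δ σ g))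

    term-sum : ∀ σ e → Σ[ (λ k → Σ[ (λ α → term σ α * mono k e) ] (αs k)) ] ks ≈ weight σ * Z σ powerSum e
    term-sum σ e with mem? σ
    ... | no  _   = ≈-trans (Σ-zero (λ k → Σ-zero (λ α → zeroˡ _) (αs k)) ks) (≈-sym (zeroˡ _))
    ... | yes σ∈G = begin
      Σ[ (λ k → Σ[ (λ α → when (inSymα? σ α) (λ _ → Δσ) * mono k e) ] (αs k)) ] ks
        ≈⟨ Σ-cong (λ k → Σ-cong (λ α → when-factor (inSymα? σ α) (mono k e)) (αs k)) ks ⟩
      Σ[ (λ k → Σ[ (λ α → Δσ * (when (inSymα? σ α) (λ _ → 1#) * mono k e)) ] (αs k)) ] ks
        ≈⟨ Σ-cong (λ k → Σ-distribˡ Δσ _ (αs k)) ks ⟩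
      Σ[ (λ k → Δσ * Σ[ (λ α → when (inSymα? σ α) (λ _ → 1#) * mono k e) ] (αs k)) ] ks
        ≈⟨ Σ-distribˡ Δσ _ ks ⟩
      Δσ * Σ[ (λ k → Σ[ (λ α → when (inSymα? σ α) (λ _ → 1#) * mono k e) ] (αs k)) ] ks
        ≈⟨ *-congˡ (symmetricBlockTupleSum σ (mem⇒perm σ∈G) e) ⟩
      Δσ * Z σ powerSum e ∎
      where
      Δσ = Δ σ σ∈G
      when-factor : ∀ {P : Set} (P? : Dec P) M → when P? (λ _ → Δσ) * M ≈ Δσ * (when P? (λ _ → 1#) * M)
      when-factor (yes _) M = *-congˡ (≈-sym (*-identityˡ M))
      when-factor (no  _) M = ≈-trans (zeroˡ M) (≈-sym (≈-trans (*-congˡ (zeroˡ M)) (zeroʳ Δσ)))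

    LHS≈RHS : LHS G Δ ≈P RHS G Δ
    LHS≈RHS e = begin
      LHS G Δ e
        ≡⟨ sumP-apply (λ k → Σ[ innerSum G Δ ] (αs k) ·P mono k) ks e ⟩
      Σ[ (λ k → Σ[ innerSum G Δ ] (αs k) * mono k e) ] ks
        ≈⟨ Σ-cong (λ k → ≈-trans (≈-sym (Σ-distribʳ (mono k e) (innerSum G Δ) (αs k)))
                                 (Σ-cong (λ α → ≈-sym (Σ-distribʳ (mono k e) (λ σ → term σ α) (allMaps n))) (αs k)))
                  ks ⟩
      Σ[ (λ k → Σ[ (λ α → Σ[ (λ σ → term σ α * mono k e) ] (allMaps n)) ] (αs k)) ] ks
        ≈⟨ Σ-cong (λ k → Σ-comm (λ α σ → term σ α * mono k e) (αs k) (allMaps n)) ks ⟩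
      Σ[ (λ k → Σ[ (λ σ → Σ[ (λ α → term σ α * mono k e) ] (αs k)) ] (allMaps n)) ] ks
        ≈⟨ Σ-comm (λ k σ → Σ[ (λ α → term σ α * mono k e) ] (αs k)) ks (allMaps n) ⟩
      Σ[ (λ σ → Σ[ (λ k → Σ[ (λ α → term σ α * mono k e) ] (αs k)) ] ks) ] (allMaps n)
        ≈⟨ Σ-cong (λ σ → term-sum σ e) (allMaps n) ⟩
      Σ[ (λ σ → weight σ * Z σ powerSum e) ] (allMaps n)
        ≡⟨ sumP-apply (λ σ → weight σ ·P Z σ powerSum) (allMaps n) e ⟨
      RHS G Δ e ∎

theorem2p1 : ∀ {c ℓ : Level} (F : CommutativeRing c ℓ) → IsField F → CharZero F →
    (n m : ℕ) → 1 ≤ n → 1 ≤ m → (G : Subgroup n) →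
    (Δ : (σ : Map n) → Subgroup.mem G σ → CommutativeRing.Carrier F) →
    PolyRing._≈P_ F m (PolyRing.LHS F m G Δ) (PolyRing.RHS F m G Δ)
theorem2p1 F _ _ n (suc m′) _ _ = Expansion.LHS≈RHS F m′
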